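{- Let $p$ be a prime and let $a,b$ be positive integers with $b>1$, such that $k=\frac{p^{ab}-1}{b(p^a-1)}$ is an integer and $b(p^a-1)$ is a primitive divisor of $p^{ab}-1$. Let $\omega$ be a primitive element of $\mathbb{F}_{p^{ab}}$, so that $\{1,\omega^k,\ldots,\omega^{(b-1)k}\}$ is an $\mathbb{F}_{p^a}$-basis of $\mathbb{F}_{p^{ab}}$, and for $\alpha\in\mathbb{F}_{p^{ab}}$ let $[\alpha]_i$ denote the $i$-th coordinate of $\alpha$ in this basis. Let $\alpha\in\mathbb{F}_{p^{ab}}$ and let $N_r$ be the number of solutions $(x_1,\ldots,x_r)\in(\mathbb{F}_{p^{ab}}^*)^r$ of $x_1^{k}+\cdots+x_{r}^k=\alpha$. Then $$N_r=k^{r}\sum_{\substack{r_1+\cdots+r_b=r\\ r_i\ge0}} \frac{r!}{r_{1}!\cdots r_{b}!}\prod_{i=1}^b a_{i}(\alpha),$$ where $$a_{i}(\alpha)=\begin{cases} \frac{p^{a}-1}{p^{a}}\big((p^{a}-1)^{r_i-1}-(-1)^{r_i-1}\big) & \text{if } [\alpha]_i=0, \\[1mm] \frac{1}{p^{a}}\big((p^{a}-1)^{r_i}-(-1)^{r_i}\big) & \text{if } [\alpha]_i\neq 0. \end{cases}$$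
   Context: A divisor $u$ of $p^m-1$ is primitive if $u\nmid p^h-1$ for all $1\le h<m$. -}

module Defs where

open import Level using (0ℓ)
open import Data.Nat as ℕ using (ℕ; zero; suc; _∸_; _≤_; _<_; _!)
open import Data.Nat.Divisibility using (_∣_)
open import Data.Fin using (Fin; toℕ)
import Data.Fin as Fin
open import Data.Vec using (Vec; []; _∷_)
import Data.Vec as Vec
open import Data.Vec.Relation.Unary.All as VAll using (All)
open import Data.List as List using (List; []; _∷_)
open import Data.Bool using (Bool; if_then_else_)
open import Data.Product using (_×_; Σ; ∃)
open import Data.Integer as ℤ using (ℤ; +_)
open import Data.Rational as ℚ using (ℚ; 0ℚ; 1ℚ)
open import Function.Bundles using (_↔_; Inverse)
open import Algebra.Structures using (IsCommutativeRing)
open import Relation.Binary.PropositionalEquality using (_≡_; _≢_)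
open import Relation.Binary.Definitions using (DecidableEquality)
open import Relation.Nullary using (¬_; ¬?)
open import Relation.Nullary.Decidable using (_×-dec_)

PrimitiveDivisor : (p m u : ℕ) → Set
PrimitiveDivisor p m u =
  (u ∣ p ℕ.^ m ∸ 1) × (∀ h → 1 ≤ h → h < m → ¬ (u ∣ p ℕ.^ h ∸ 1))

record FiniteField : Set₁ where
  infixl 6 _+_
  infixl 7 _*_
  field
    Carrier : Set
    _+_ _*_ : Carrier → Carrier → Carrier
    -_      : Carrier → Carrier
    0# 1#   : Carrier
    isCommutativeRing : IsCommutativeRing _≡_ _+_ _*_ -_ 0# 1#
    0≢1     : 0# ≢ 1#
    inverse : ∀ x → x ≢ 0# → ∃ λ y → x * y ≡ 1#
    _≟_     : DecidableEquality Carrier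
    size    : ℕ
    enum    : Fin size ↔ Carrier

  infixr 8 _^_
  _^_ : Carrier → ℕ → Carrier
  x ^ zero  = 1#
  x ^ suc n = x * (x ^ n)

  IsPrimitiveElement : Carrier → Set
  IsPrimitiveElement ω = ∀ x → x ≢ 0# → ∃ λ j → ω ^ j ≡ x

  sumFin : (n : ℕ) → (Fin n → Carrier) → Carrier
  sumFin zero    f = 0#
  sumFin (suc n) f = f Fin.zero + sumFin n (λ i → f (Fin.suc i))

  -- c is the coordinate vector of α in the basis
  -- 1, ω^k, ..., ω^((b-1)k) over the subfield F_q = {x | x^q = x}:
  -- coordinate with index i (i = 0, …, b-1) belongs to ω^(i k).
  IsCoordinates : (q b k : ℕ) (ω α : Carrier) → (Fin b → Carrier) → Set
  IsCoordinates q b k ω α c =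
    (∀ i → c i ^ q ≡ c i) × (α ≡ sumFin b (λ i → c i * ω ^ (toℕ i ℕ.* k)))

  elements : List Carrier
  elements = List.map (Inverse.to enum) (List.allFin size)

  allTuples : (r : ℕ) → List (Vec Carrier r)
  allTuples zero    = [] ∷ []
  allTuples (suc r) =
    List.concatMap (λ x → List.map (x ∷_) (allTuples r)) elements

  sumPow : ∀ {r} → ℕ → Vec Carrier r → Carrier
  sumPow k []       = 0#
  sumPow k (x ∷ xs) = x ^ k + sumPow k xs

  numSolutions : (r k : ℕ) → Carrier → ℕ
  numSolutions r k α = List.length (List.filter
    (λ xs → VAll.all? (λ x → ¬? (x ≟ 0#)) xs ×-dec (sumPow k xs ≟ α))
    (allTuples r))

-- 1/n as a rational (with the irrelevant convention 1/0 = 0)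
invℕ : ℕ → ℚ
invℕ zero    = 0ℚ
invℕ (suc n) = + 1 ℚ./ suc n

ℕ→ℚ : ℕ → ℚ
ℕ→ℚ n = + n ℚ./ 1

ℤ→ℚ : ℤ → ℚ
ℤ→ℚ z = z ℚ./ 1

compositions : (b r : ℕ) → List (Vec ℕ b)
compositions zero    zero    = [] ∷ []
compositions zero    (suc r) = []
compositions (suc b) r =
  List.concatMap (λ r₁ → List.map (r₁ ∷_) (compositions b (r ∸ r₁)))
                 (List.upTo (suc r))

multinomial : ∀ {b} → ℕ → Vec ℕ b → ℚ
multinomial r rs =
  ℕ→ℚ (r !) ℚ.* Vec.foldr _ (λ rᵢ acc → invℕ (rᵢ !) ℚ.* acc) 1ℚ rs

-- a_i(α) when [α]_i = 0 :  (q-1)/q · ((q-1)^(rᵢ-1) - (-1)^(rᵢ-1)).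
-- For rᵢ = 0 the exponent is -1 and the expression evaluates to
-- (q-1)/q · (1/(q-1) + 1) = 1.
aZero : (q rᵢ : ℕ) → ℚ
aZero q zero     = 1ℚ
aZero q (suc rᵢ) = ℕ→ℚ (q ∸ 1) ℚ.* invℕ q ℚ.*
  ℤ→ℚ ((+ (q ∸ 1)) ℤ.^ rᵢ ℤ.- (ℤ.- (+ 1)) ℤ.^ rᵢ)

aNonZero : (q rᵢ : ℕ) → ℚ
aNonZero q rᵢ = invℕ q ℚ.* ℤ→ℚ ((+ (q ∸ 1)) ℤ.^ rᵢ ℤ.- (ℤ.- (+ 1)) ℤ.^ rᵢ)

prodA : (q : ℕ) {b : ℕ} → (Fin b → Bool) → Vec ℕ b → ℚ
prodA q isZero rs = Vec.foldr _ ℚ._*_ 1ℚ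
  (Vec.tabulate (λ i → if isZero i then aZero q (Vec.lookup rs i)
                                  else aNonZero q (Vec.lookup rs i)))

formula : (q b k r : ℕ) → (Fin b → Bool) → ℚ
formula q b k r isZero = ℕ→ℚ (k ℕ.^ r) ℚ.*
  List.foldr ℚ._+_ 0ℚ
    (List.map (λ rs → multinomial r rs ℚ.* prodA q isZero rs) (compositions b r))

module Submission where

-- Write α = ∑ cᵢ θⁱ with θ = ω^k and cᵢ ∈ 𝔽_q, q = p^a. Since p^(ab) - 1 = k b (q - 1), the map x ↦ x^k sends
-- the nonzero x onto the elements σ θⁱ (σ ∈ 𝔽_q^*, i < b), each hit exactly k times, so
-- N_{r+1}(α) = k ∑_{σ,i} N_r(α - σ θⁱ), where α - σ θⁱ differs from α only in its i-th coordinate.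
-- The right-hand side, rewritten as an iterated binomial convolution over the b coordinates, obeys the same
-- recursion because a(r + 1, c) = ∑_{σ ∈ 𝔽_q^*} a(r, c - σ) for c ∈ 𝔽_q. For r = 0 both sides are [α = 0]:
-- the conjugates θ^(q^j), j < b, are distinct since b (q - 1) is a primitive divisor, so ∑ cᵢ Xⁱ, of degree
-- < b, cannot vanish at all of them unless every cᵢ is 0.

open import Level using (0ℓ)
open import Defs
open import Algebra.Bundles using (CommutativeMonoid; CommutativeRing; CommutativeSemiring)
open import Algebra.Structures using (IsCommutativeMonoid; IsCommutativeSemiring; IsCommutativeRing)
open import Data.Bool using (true; false; if_then_else_; not; _∧_)
open import Data.Empty using (⊥-elim)
open import Data.Fin as Fin using (Fin; toℕ)
import Data.Fin.Properties as Fin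
open import Data.Fin.Permutation using (Permutation; _⟨$⟩ʳ_)
import Data.Integer as ℤ
import Data.Integer.Properties as ℤ
import Data.Integer.Tactic.RingSolver as ℤ-Solver
open import Data.List as List using (List; []; _∷_; _++_)
import Data.List.Properties as List
open import Data.Maybe using (Maybe; just; nothing)
open import Data.Nat as ℕ using (ℕ; zero; suc; _∸_; _<_; _≤_; z≤n; s≤s; _!; NonZero)
import Data.Nat.Properties as ℕ
open import Data.Nat.Combinatorics
  using (_C_; k>n⇒nCk≡0; nCk+nC[k+1]≡[n+1]C[k+1]; nCk≡n!/k![n-k]!; k![n∸k]!∣n!; nCn≡1)
open import Data.Nat.DivMod using (_%_; _/_; m/n*n≡m; m≡m%n+[m/n]*n; m%n<n)
open import Data.Nat.Divisibility as ℕ∣ using (_∣_; divides; ∣⇒≤; ∣1⇒≡1; m∣m*n; m%n≡0⇒n∣m)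
open import Data.Nat.Primality using (Prime; euclidsLemma; prime⇒nonZero; prime⇒nonTrivial)
open import Data.Nat.Tactic.RingSolver using (solve-∀)
open import Data.Product using (_,_; proj₁; proj₂; ∃; _×_)
open import Data.Rational as ℚ using (ℚ; 0ℚ; 1ℚ)
import Data.Rational.Properties as ℚ
import Data.Rational.Unnormalised as ℚᵘ
import Data.Rational.Unnormalised.Properties as ℚᵘ
open import Data.Sum using (_⊎_; inj₁; inj₂)
open import Data.Vec as Vec using (Vec; []; _∷_)
open import Data.Vec.Functional using (updateAt)
open import Data.Vec.Functional.Properties using (updateAt-updates; updateAt-minimal)
import Data.Vec.Relation.Unary.All as VAll
open import Function using (_∘_; _↔_; Inverse; mk↔ₛ′)
open import Function.Construct.Composition using (_↔-∘_)
open import Function.Construct.Symmetry using (↔-sym)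
open import Relation.Binary.Definitions using (Tri; tri<; tri≈; tri>)
open import Relation.Binary.PropositionalEquality
open import Relation.Nullary using (¬_; ¬?; Dec; yes; no; does)
open import Relation.Nullary.Decidable using (isYes; isYes≗does; _×-dec_; dec-true; dec-false)
open import Tactic.RingSolver.Core.AlmostCommutativeRing using (AlmostCommutativeRing; fromCommutativeRing)
import Tactic.RingSolver as ℚ-Solver

module Sums {A : Set} {_+_ : A → A → A} {0# : A}
            (isCM : IsCommutativeMonoid _≡_ _+_ 0#) where

  private
    commutativeMonoid : CommutativeMonoid 0ℓ 0ℓ
    commutativeMonoid = record { isCommutativeMonoid = isCM }

  open CommutativeMonoid commutativeMonoid using (assoc; comm; identityˡ; identityʳ; commutativeSemigroup)
  open import Algebra.Properties.CommutativeSemigroup commutativeSemigroup using (interchange)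
  open import Algebra.Properties.CommutativeMonoid.Sum commutativeMonoid public
    using (sum; sum-syntax; sum-cong-≗; ∑-distrib-+; ∑-permute; sum-replicate; sum-replicate-zero)

  ∑< : ℕ → (ℕ → A) → A
  ∑< zero    f = 0#
  ∑< (suc n) f = ∑< n f + f n

  ∑ˡ : {X : Set} → List X → (X → A) → A
  ∑ˡ []       f = 0#
  ∑ˡ (x ∷ xs) f = f x + ∑ˡ xs f

  ∑<-cong : ∀ n {f g : ℕ → A} → (∀ i → i < n → f i ≡ g i) → ∑< n f ≡ ∑< n g
  ∑<-cong zero    eq = refl
  ∑<-cong (suc n) eq = cong₂ _+_ (∑<-cong n λ i i<n → eq i (ℕ.m<n⇒m<1+n i<n)) (eq n ℕ.≤-refl)

  ∑<-distrib-+ : ∀ n (f g : ℕ → A) → ∑< n (λ i → f i + g i) ≡ ∑< n f + ∑< n g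
  ∑<-distrib-+ zero    f g = sym (identityˡ 0#)
  ∑<-distrib-+ (suc n) f g = trans (cong (_+ (f n + g n)) (∑<-distrib-+ n f g)) (interchange _ _ _ _)

  ∑<-zero : ∀ n {f : ℕ → A} → (∀ i → i < n → f i ≡ 0#) → ∑< n f ≡ 0#
  ∑<-zero zero    eq = refl
  ∑<-zero (suc n) eq =
    trans (cong₂ _+_ (∑<-zero n λ i i<n → eq i (ℕ.m<n⇒m<1+n i<n)) (eq n ℕ.≤-refl)) (identityˡ 0#)

  ∑<-head : ∀ n (f : ℕ → A) → ∑< (suc n) f ≡ f 0 + ∑< n (f ∘ suc)
  ∑<-head zero    f = trans (identityˡ _) (sym (identityʳ _))
  ∑<-head (suc n) f = trans (cong (_+ f (suc n)) (∑<-head n f)) (assoc _ _ _)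

  ∑<-split : ∀ m n (f : ℕ → A) → ∑< (m ℕ.+ n) f ≡ ∑< m f + ∑< n (λ i → f (m ℕ.+ i))
  ∑<-split m zero    f = trans (cong (λ z → ∑< z f) (ℕ.+-identityʳ m)) (sym (identityʳ _))
  ∑<-split m (suc n) f =
    trans (cong (λ z → ∑< z f) (ℕ.+-suc m n))
          (trans (cong (_+ f (m ℕ.+ n)) (∑<-split m n f)) (assoc _ _ _))

  ∑<-comm : ∀ m n (f : ℕ → ℕ → A) → ∑< m (λ i → ∑< n (f i)) ≡ ∑< n (λ j → ∑< m (λ i → f i j))
  ∑<-comm zero    n f = sym (∑<-zero n λ _ _ → refl)
  ∑<-comm (suc m) n f = trans (cong (_+ ∑< n (f m)) (∑<-comm m n f))
                              (sym (∑<-distrib-+ n (λ j → ∑< m (λ i → f i j)) (f m)))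

  ∑<-delta : ∀ n {f : ℕ → A} i₀ → i₀ < n → (∀ i → i < n → i ≢ i₀ → f i ≡ 0#) → ∑< n f ≡ f i₀
  ∑<-delta (suc n) {f} i₀ i₀<1+n eq with ℕ.<-cmp i₀ n
  ... | tri< i₀<n _ _ =
    trans (cong₂ _+_ (∑<-delta n i₀ i₀<n λ i i<n → eq i (ℕ.m<n⇒m<1+n i<n))
                     (eq n ℕ.≤-refl λ n≡i₀ → ℕ.<-irrefl (sym n≡i₀) i₀<n))
          (identityʳ _)
  ... | tri≈ _ refl _ =
    trans (cong (_+ f n) (∑<-zero n λ i i<n → eq i (ℕ.m<n⇒m<1+n i<n) λ i≡n → ℕ.<-irrefl i≡n i<n))
          (identityˡ _)
  ... | tri> _ _ n<i₀ = ⊥-elim (ℕ.<-irrefl refl (ℕ.<-≤-trans n<i₀ (ℕ.≤-pred i₀<1+n)))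

  ∑<-periodic : ∀ k d (f : ℕ → A) → (∀ m → f (d ℕ.+ m) ≡ f m) →
                ∑< (k ℕ.* d) f ≡ ∑< k (λ _ → ∑< d f)
  ∑<-periodic zero    d f per = refl
  ∑<-periodic (suc k) d f per =
    trans (∑<-split d (k ℕ.* d) f)
          (trans (cong (∑< d f +_) (trans (∑<-cong (k ℕ.* d) λ i _ → per i) (∑<-periodic k d f per)))
                 (comm _ _))

  ∑<-blocks : ∀ m b (f : ℕ → A) → ∑< (m ℕ.* b) f ≡ ∑< m (λ t → ∑< b (λ i → f (t ℕ.* b ℕ.+ i)))
  ∑<-blocks zero    b f = refl
  ∑<-blocks (suc m) b f =
    trans (cong (λ z → ∑< z f) (ℕ.+-comm b (m ℕ.* b)))
          (trans (∑<-split (m ℕ.* b) b f) (cong (_+ ∑< b (λ i → f (m ℕ.* b ℕ.+ i))) (∑<-blocks m b f)))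

  ∑-zero : ∀ n {f : Fin n → A} → (∀ i → f i ≡ 0#) → ∑[ i < n ] f i ≡ 0#
  ∑-zero n eq = trans (sum-cong-≗ eq) (sum-replicate-zero n)

  ∑-delta : ∀ n {f : Fin n → A} i₀ → (∀ i → i ≢ i₀ → f i ≡ 0#) → ∑[ i < n ] f i ≡ f i₀
  ∑-delta (suc n) Fin.zero      eq =
    trans (cong (_ +_) (∑-zero n λ i → eq (Fin.suc i) λ ())) (identityʳ _)
  ∑-delta (suc n) (Fin.suc i₀) eq =
    trans (cong₂ _+_ (eq Fin.zero λ ()) (∑-delta n i₀ λ i i≢i₀ → eq (Fin.suc i) (i≢i₀ ∘ Fin.suc-injective)))
          (identityˡ _)

  ∑-comm-∑< : ∀ m n (f : Fin m → ℕ → A) → ∑[ i < m ] ∑< n (f i) ≡ ∑< n (λ j → ∑[ i < m ] f i j)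
  ∑-comm-∑< zero    n f = sym (∑<-zero n λ _ _ → refl)
  ∑-comm-∑< (suc m) n f = trans (cong (∑< n (f Fin.zero) +_) (∑-comm-∑< m n _)) (sym (∑<-distrib-+ n _ _))

  ∑-toℕ : ∀ n (f : ℕ → A) → ∑[ i < n ] f (toℕ i) ≡ ∑< n f
  ∑-toℕ zero    f = refl
  ∑-toℕ (suc n) f = trans (cong (f 0 +_) (∑-toℕ n (f ∘ suc))) (sym (∑<-head n f))

  foldr-map≡∑ˡ : ∀ {X} (xs : List X) (f : X → A) → List.foldr _+_ 0# (List.map f xs) ≡ ∑ˡ xs f
  foldr-map≡∑ˡ []       f = refl
  foldr-map≡∑ˡ (x ∷ xs) f = cong (f x +_) (foldr-map≡∑ˡ xs f)

  ∑ˡ-cong : ∀ {X} (xs : List X) {f g : X → A} → (∀ x → f x ≡ g x) → ∑ˡ xs f ≡ ∑ˡ xs g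
  ∑ˡ-cong []       eq = refl
  ∑ˡ-cong (x ∷ xs) eq = cong₂ _+_ (eq x) (∑ˡ-cong xs eq)

  ∑ˡ-map : ∀ {X Y} (g : X → Y) (xs : List X) (f : Y → A) → ∑ˡ (List.map g xs) f ≡ ∑ˡ xs (f ∘ g)
  ∑ˡ-map g []       f = refl
  ∑ˡ-map g (x ∷ xs) f = cong (f (g x) +_) (∑ˡ-map g xs f)

  ∑ˡ-++ : ∀ {X} (xs ys : List X) (f : X → A) → ∑ˡ (xs ++ ys) f ≡ ∑ˡ xs f + ∑ˡ ys f
  ∑ˡ-++ []       ys f = sym (identityˡ _)
  ∑ˡ-++ (x ∷ xs) ys f = trans (cong (f x +_) (∑ˡ-++ xs ys f)) (sym (assoc _ _ _))

  ∑ˡ-concatMap : ∀ {X Y} (g : X → List Y) (xs : List X) (f : Y → A) →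
                 ∑ˡ (List.concatMap g xs) f ≡ ∑ˡ xs (λ x → ∑ˡ (g x) f)
  ∑ˡ-concatMap g []       f = refl
  ∑ˡ-concatMap g (x ∷ xs) f = trans (∑ˡ-++ (g x) _ f) (cong (_ +_) (∑ˡ-concatMap g xs f))

  ∑ˡ-tabulate : ∀ {X} n (g : Fin n → X) (f : X → A) → ∑ˡ (List.tabulate g) f ≡ ∑[ i < n ] f (g i)
  ∑ˡ-tabulate zero    g f = refl
  ∑ˡ-tabulate (suc n) g f = cong (_ +_) (∑ˡ-tabulate n (g ∘ Fin.suc) f)

  ∑ˡ-applyUpTo : ∀ {X} n (g : ℕ → X) (f : X → A) → ∑ˡ (List.applyUpTo g n) f ≡ ∑< n (f ∘ g)
  ∑ˡ-applyUpTo zero    g f = refl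
  ∑ˡ-applyUpTo (suc n) g f =
    trans (cong (f (g 0) +_) (∑ˡ-applyUpTo n (g ∘ suc) f)) (sym (∑<-head n (f ∘ g)))

module SemiringSums {A : Set} {add mul : A → A → A} {0# 1# : A}
                    (isCS : IsCommutativeSemiring _≡_ add mul 0# 1#) where

  private
    R : CommutativeSemiring 0ℓ 0ℓ
    R = record { isCommutativeSemiring = isCS }

  open CommutativeSemiring R
    using (_+_; _*_; +-identityʳ; +-isCommutativeMonoid; +-commutativeSemigroup; distribˡ; distribʳ; zeroˡ; zeroʳ;
           *-assoc; semiring; *-commutativeSemigroup)
  open Sums +-isCommutativeMonoid public
  open import Algebra.Properties.Semiring.Sum semiring public using (*-distribˡ-sum)
  open import Algebra.Properties.Semiring.Mult semiring public using (×-homo-+) renaming (_×_ to _·_)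
  open import Algebra.Properties.CommutativeSemigroup *-commutativeSemigroup using (x∙yz≈y∙xz)

  *-distribˡ-∑< : ∀ n c (f : ℕ → A) → c * ∑< n f ≡ ∑< n (λ i → c * f i)
  *-distribˡ-∑< zero    c f = zeroʳ c
  *-distribˡ-∑< (suc n) c f = trans (distribˡ c _ _) (cong (_+ c * f n) (*-distribˡ-∑< n c f))

  *-distribʳ-∑< : ∀ n c (f : ℕ → A) → ∑< n f * c ≡ ∑< n (λ i → f i * c)
  *-distribʳ-∑< zero    c f = zeroˡ c
  *-distribʳ-∑< (suc n) c f = trans (distribʳ c _ _) (cong (_+ f n * c) (*-distribʳ-∑< n c f))

  *-distribˡ-∑ˡ : ∀ {X} (xs : List X) c (f : X → A) → c * ∑ˡ xs f ≡ ∑ˡ xs (λ x → c * f x)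
  *-distribˡ-∑ˡ []       c f = zeroʳ c
  *-distribˡ-∑ˡ (x ∷ xs) c f = trans (distribˡ c _ _) (cong (c * f x +_) (*-distribˡ-∑ˡ xs c f))

  conv : ℕ → (ℕ → A) → (ℕ → A) → A
  conv r f g = ∑< (suc r) (λ i → (r C i) · 1# * (f i * g (r ∸ i)))

  conv-cong : ∀ r {f f′ g g′ : ℕ → A} → (∀ i → i ≤ r → f i ≡ f′ i) → (∀ i → i ≤ r → g i ≡ g′ i) →
              conv r f g ≡ conv r f′ g′
  conv-cong r eqf eqg = ∑<-cong (suc r) λ i i≤r →
    cong₂ (λ x y → (r C i) · 1# * (x * y)) (eqf i (ℕ.≤-pred i≤r)) (eqg (r ∸ i) (ℕ.m∸n≤m r i))

  conv-suc : ∀ r (f g : ℕ → A) → conv (suc r) f g ≡ conv r (f ∘ suc) g + conv r f (g ∘ suc)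
  conv-suc r f g = begin
      ∑< (suc (suc r)) h
        ≡⟨ ∑<-head (suc r) h ⟩
      k 0 + ∑< (suc r) (h ∘ suc)
        ≡⟨ cong (k 0 +_) (trans (∑<-cong (suc r) λ s _ → pascal s)
                               (∑<-distrib-+ (suc r) l u)) ⟩
      k 0 + (∑< (suc r) l + ∑< (suc r) u)
        ≡⟨ x+[y+z]≡y+[x+z] (k 0) _ _ ⟩
      ∑< (suc r) l + (k 0 + ∑< (suc r) u)
        ≡⟨ cong (λ z → ∑< (suc r) l + (k 0 + z)) upper ⟩
      ∑< (suc r) l + (k 0 + ∑< r (k ∘ suc))
        ≡⟨ cong (∑< (suc r) l +_) (sym (∑<-head r k)) ⟩
      conv r (f ∘ suc) g + conv r f (g ∘ suc)         ∎
    where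
    open ≡-Reasoning
    open import Algebra.Properties.CommutativeSemigroup +-commutativeSemigroup
      using () renaming (x∙yz≈y∙xz to x+[y+z]≡y+[x+z])
    h = λ i → (suc r C i) · 1# * (f i * g (suc r ∸ i))
    k = λ i → (r C i) · 1# * (f i * g (suc (r ∸ i)))
    l = λ s → (r C s) · 1# * (f (suc s) * g (r ∸ s))
    u = λ s → (r C suc s) · 1# * (f (suc s) * g (r ∸ s))
    pascal : ∀ s → h (suc s) ≡ l s + u s
    pascal s = trans (cong (λ c → c · 1# * (f (suc s) * g (r ∸ s))) (sym (nCk+nC[k+1]≡[n+1]C[k+1] r s)))
                     (trans (cong (_* (f (suc s) * g (r ∸ s))) (×-homo-+ 1# (r C s) (r C suc s)))
                            (distribʳ _ _ _))
    upper : ∑< (suc r) u ≡ ∑< r (k ∘ suc)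
    upper = trans (cong (∑< r u +_) (trans (cong (λ c → c · 1# * (f (suc r) * g (r ∸ r))) (k>n⇒nCk≡0 (ℕ.n<1+n r)))
                                           (zeroˡ _)))
                  (trans (+-identityʳ _)
                         (∑<-cong r λ s s<r → cong (λ m → (r C suc s) · 1# * (f (suc s) * g m)) (ℕ.+-∸-assoc 1 s<r)))

  conv-*ˡ : ∀ r c (f g : ℕ → A) → conv r (λ i → c * f i) g ≡ c * conv r f g
  conv-*ˡ r c f g =
    trans (∑<-cong (suc r) λ i _ → trans (cong ((r C i) · 1# *_) (*-assoc c _ _)) (x∙yz≈y∙xz _ c _))
          (sym (*-distribˡ-∑< (suc r) c _))

  conv-*ʳ : ∀ r c (f g : ℕ → A) → conv r f (λ i → c * g i) ≡ c * conv r f g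
  conv-*ʳ r c f g =
    trans (∑<-cong (suc r) λ i _ → trans (cong ((r C i) · 1# *_) (x∙yz≈y∙xz (f i) c _)) (x∙yz≈y∙xz _ c _))
          (sym (*-distribˡ-∑< (suc r) c _))

  conv-∑<ˡ : ∀ r n (f : ℕ → ℕ → A) g → conv r (λ i → ∑< n (λ t → f t i)) g ≡ ∑< n (λ t → conv r (f t) g)
  conv-∑<ˡ r n f g =
    trans (∑<-cong (suc r) λ i _ → trans (cong ((r C i) · 1# *_) (*-distribʳ-∑< n _ _)) (*-distribˡ-∑< n _ _))
          (∑<-comm (suc r) n _)

  conv-∑<ʳ : ∀ r n f (g : ℕ → ℕ → A) → conv r f (λ i → ∑< n (λ t → g t i)) ≡ ∑< n (λ t → conv r f (g t))
  conv-∑<ʳ r n f g =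
    trans (∑<-cong (suc r) λ i _ → trans (cong ((r C i) · 1# *_) (*-distribˡ-∑< n _ _)) (*-distribˡ-∑< n _ _))
          (∑<-comm (suc r) n _)

  conv-∑ʳ : ∀ r n f (g : Fin n → ℕ → A) → conv r f (λ i → ∑[ j < n ] g j i) ≡ ∑[ j < n ] conv r f (g j)
  conv-∑ʳ r n f g =
    trans (∑<-cong (suc r) λ i _ → trans (cong ((r C i) · 1# *_) (*-distribˡ-sum (f i) (λ j → g j (r ∸ i))))
                                         (*-distribˡ-sum ((r C i) · 1#) (λ j → f i * g j (r ∸ i))))
          (sym (∑-comm-∑< n (suc r) _))

module ℕSums where

  open Sums ℕ.+-0-isCommutativeMonoid public

  length-filter : ∀ {X : Set} {P : X → Set} (P? : ∀ x → Dec (P x)) (xs : List X) →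
                  List.length (List.filter P? xs) ≡ ∑ˡ xs (λ x → if does (P? x) then 1 else 0)
  length-filter P? []       = refl
  length-filter P? (x ∷ xs) with does (P? x)
  ... | true  = cong suc (length-filter P? xs)
  ... | false = length-filter P? xs

module ℚSums = SemiringSums (IsCommutativeRing.isCommutativeSemiring ℚ.+-*-isCommutativeRing)

module Binomials where

  C-factorials : ∀ {n k} → k ≤ n → (n C k) ℕ.* (k ! ℕ.* (n ∸ k) !) ≡ n !
  C-factorials {n} {k} k≤n = trans (cong (ℕ._* (k ! ℕ.* (n ∸ k) !)) (nCk≡n!/k![n-k]! k≤n)) (m/n*n≡m (k![n∸k]!∣n! k≤n))
    where instance _ = ℕ._!*_!≢0 k (n ∸ k)

  prime∤! : ∀ {p m} → Prime p → m < p → ¬ p ∣ m !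
  prime∤! {p} {zero}  pp _   p∣1 = ℕ.<-irrefl (sym (∣1⇒≡1 p∣1)) (ℕ.nonTrivial⇒n>1 p {{prime⇒nonTrivial pp}})
  prime∤! {p} {suc m} pp m<p p∣ with euclidsLemma (suc m) (m !) pp p∣
  ... | inj₁ p∣1+m = ℕ.<⇒≱ m<p (∣⇒≤ p∣1+m)
  ... | inj₂ p∣m!  = prime∤! pp (ℕ.<-trans (ℕ.n<1+n m) m<p) p∣m!

  prime∣C : ∀ {p i} → Prime p → 0 < i → i < p → p ∣ p C i
  prime∣C {suc p} {i} pp 0<i i<p
    with euclidsLemma (suc p C i) (i ! ℕ.* (suc p ∸ i) !) pp
           (subst (suc p ∣_) (sym (C-factorials (ℕ.<⇒≤ i<p))) (m∣m*n (p !)))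
  ... | inj₁ p∣C = p∣C
  ... | inj₂ p∣i![p-i]! with euclidsLemma (i !) ((suc p ∸ i) !) pp p∣i![p-i]!
  ...   | inj₁ p∣i!     = ⊥-elim (prime∤! pp i<p p∣i!)
  ...   | inj₂ p∣[p-i]! = ⊥-elim (prime∤! pp (ℕ.∸-monoʳ-< 0<i (ℕ.<⇒≤ i<p)) p∣[p-i]!)

module RationalCasts where

  open import Data.Integer using (+_)
  open import Data.Rational using (_+_; _*_; -_; _-_)

  ℚ-ring : AlmostCommutativeRing _ _
  ℚ-ring = fromCommutativeRing ℚ.+-*-commutativeRing ℚ0?
    where
    ℚ0? : (x : ℚ) → Maybe (0ℚ ≡ x)
    ℚ0? x with 0ℚ ℚ.≟ x
    ... | yes 0≡x = just 0≡x
    ... | no  _   = nothing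

  private
    toℚᵘ-ℤ→ℚ : ∀ i → ℚ.toℚᵘ (ℤ→ℚ i) ℚᵘ.≃ ℚᵘ.mkℚᵘ i 0
    toℚᵘ-ℤ→ℚ i = ℚ.toℚᵘ-fromℚᵘ (ℚᵘ.mkℚᵘ i 0)

  ℤ→ℚ-homo-+ : ∀ i j → ℤ→ℚ (i ℤ.+ j) ≡ ℤ→ℚ i + ℤ→ℚ j
  ℤ→ℚ-homo-+ i j = ℚ.toℚᵘ-injective (ℚᵘ.≃-trans (toℚᵘ-ℤ→ℚ (i ℤ.+ j))
    (ℚᵘ.≃-trans (ℚᵘ.*≡* (ℤ-identity i j))
      (ℚᵘ.≃-sym (ℚᵘ.≃-trans (ℚ.toℚᵘ-homo-+ (ℤ→ℚ i) (ℤ→ℚ j)) (ℚᵘ.+-cong (toℚᵘ-ℤ→ℚ i) (toℚᵘ-ℤ→ℚ j))))))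
    where
    ℤ-identity : ∀ i j → (i ℤ.+ j) ℤ.* (+ 1 ℤ.* + 1) ≡ (i ℤ.* + 1 ℤ.+ j ℤ.* + 1) ℤ.* + 1
    ℤ-identity = ℤ-Solver.solve-∀

  ℤ→ℚ-homo-* : ∀ i j → ℤ→ℚ (i ℤ.* j) ≡ ℤ→ℚ i * ℤ→ℚ j
  ℤ→ℚ-homo-* i j = ℚ.toℚᵘ-injective (ℚᵘ.≃-trans (toℚᵘ-ℤ→ℚ (i ℤ.* j))
    (ℚᵘ.≃-trans (ℚᵘ.*≡* (ℤ-identity i j))
      (ℚᵘ.≃-sym (ℚᵘ.≃-trans (ℚ.toℚᵘ-homo-* (ℤ→ℚ i) (ℤ→ℚ j)) (ℚᵘ.*-cong (toℚᵘ-ℤ→ℚ i) (toℚᵘ-ℤ→ℚ j))))))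
    where
    ℤ-identity : ∀ i j → (i ℤ.* j) ℤ.* (+ 1 ℤ.* + 1) ≡ (i ℤ.* j) ℤ.* + 1
    ℤ-identity = ℤ-Solver.solve-∀

  ℤ→ℚ-homo‿- : ∀ i → ℤ→ℚ (ℤ.- i) ≡ - ℤ→ℚ i
  ℤ→ℚ-homo‿- i = ℚ.toℚᵘ-injective (ℚᵘ.≃-trans (toℚᵘ-ℤ→ℚ (ℤ.- i))
    (ℚᵘ.≃-sym (ℚᵘ.≃-trans (ℚ.toℚᵘ-homo‿- (ℤ→ℚ i)) (ℚᵘ.-‿cong (toℚᵘ-ℤ→ℚ i)))))

  ℤ→ℚ-homo-− : ∀ i j → ℤ→ℚ (i ℤ.- j) ≡ ℤ→ℚ i - ℤ→ℚ j
  ℤ→ℚ-homo-− i j = trans (ℤ→ℚ-homo-+ i (ℤ.- j)) (cong (λ z → ℤ→ℚ i + z) (ℤ→ℚ-homo‿- j))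

  ℕ→ℚ-homo-+ : ∀ m n → ℕ→ℚ (m ℕ.+ n) ≡ ℕ→ℚ m + ℕ→ℚ n
  ℕ→ℚ-homo-+ m n = trans (cong ℤ→ℚ (ℤ.pos-+ m n)) (ℤ→ℚ-homo-+ (+ m) (+ n))

  ℕ→ℚ-homo-* : ∀ m n → ℕ→ℚ (m ℕ.* n) ≡ ℕ→ℚ m * ℕ→ℚ n
  ℕ→ℚ-homo-* m n = trans (cong ℤ→ℚ (ℤ.pos-* m n)) (ℤ→ℚ-homo-* (+ m) (+ n))

  ℕ→ℚ*invℕ≡1 : ∀ n .{{_ : ℕ.NonZero n}} → ℕ→ℚ n * invℕ n ≡ 1ℚ
  ℕ→ℚ*invℕ≡1 (suc n) = ℚ.toℚᵘ-injective (ℚᵘ.≃-trans (ℚ.toℚᵘ-homo-* (ℕ→ℚ (suc n)) (invℕ (suc n)))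
    (ℚᵘ.≃-trans (ℚᵘ.*-cong (toℚᵘ-ℤ→ℚ (+ suc n)) (ℚ.toℚᵘ-fromℚᵘ (ℚᵘ.mkℚᵘ (+ 1) n)))
                (ℚᵘ.*≡* (ℤ-identity (+ suc n)))))
    where
    ℤ-identity : ∀ x → (x ℤ.* + 1) ℤ.* + 1 ≡ + 1 ℤ.* (+ 1 ℤ.* x)
    ℤ-identity = ℤ-Solver.solve-∀

  ℕ→ℚ-× : ∀ n x → n ℚSums.· x ≡ ℕ→ℚ n * x
  ℕ→ℚ-× zero    x = sym (ℚ.*-zeroˡ x)
  ℕ→ℚ-× (suc n) x = begin
    x + n ℚSums.· x        ≡⟨ cong₂ _+_ (sym (ℚ.*-identityˡ x)) (ℕ→ℚ-× n x) ⟩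
    1ℚ * x + ℕ→ℚ n * x     ≡⟨ sym (ℚ.*-distribʳ-+ x 1ℚ (ℕ→ℚ n)) ⟩
    (1ℚ + ℕ→ℚ n) * x       ≡⟨ cong (_* x) (sym (ℕ→ℚ-homo-+ 1 n)) ⟩
    ℕ→ℚ (suc n) * x        ∎
    where open ≡-Reasoning

  ℕ→ℚ-∑ˡ : ∀ {X : Set} (xs : List X) f → ℕ→ℚ (ℕSums.∑ˡ xs f) ≡ ℚSums.∑ˡ xs (ℕ→ℚ ∘ f)
  ℕ→ℚ-∑ˡ []       f = refl
  ℕ→ℚ-∑ˡ (x ∷ xs) f = trans (ℕ→ℚ-homo-+ (f x) _) (cong (λ s → ℕ→ℚ (f x) + s) (ℕ→ℚ-∑ˡ xs f))

  ∑<-const : ∀ n x → ℚSums.∑< n (λ _ → x) ≡ ℕ→ℚ n * x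
  ∑<-const n x = trans (sym (ℚSums.∑-toℕ n (λ _ → x))) (trans (ℚSums.sum-replicate n) (ℕ→ℚ-× n x))

module Coefficients where

  open import Data.Integer using (+_)
  open import Data.Rational using (_+_; _*_; _-_)
  open RationalCasts

  aZero-suc : ∀ q m → aZero q (suc m) ≡ ℕ→ℚ (q ∸ 1) * aNonZero q m
  aZero-suc q m = ℚ.*-assoc (ℕ→ℚ (q ∸ 1)) (invℕ q) _

  aNonZero-zero : ∀ q → aNonZero q 0 ≡ 0ℚ
  aNonZero-zero q = ℚ.*-zeroʳ (invℕ q)

  aNonZero-suc : ∀ Q m → aNonZero (suc Q) (suc m) ≡
                 ℕ→ℚ Q * aNonZero (suc Q) m + (aZero (suc Q) m - aNonZero (suc Q) m)
  aNonZero-suc Q zero = begin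
    w * ℤ→ℚ (+ Q ℤ.* + 1 ℤ.- (ℤ.- + 1) ℤ.* + 1)
      ≡⟨ cong (λ z → w * ℤ→ℚ z) (trans (ℤ-identity′ (+ Q)) (sym (ℤ.pos-+ 1 Q))) ⟩
    w * ℕ→ℚ (suc Q)
      ≡⟨ ℚ.*-comm w _ ⟩
    ℕ→ℚ (suc Q) * w
      ≡⟨ ℕ→ℚ*invℕ≡1 (suc Q) ⟩
    1ℚ
      ≡⟨ sym (ℚ-identity′ (ℕ→ℚ Q)) ⟩
    ℕ→ℚ Q * 0ℚ + (1ℚ - 0ℚ)
      ≡⟨ sym (cong₂ (λ x y → ℕ→ℚ Q * x + (1ℚ - y)) (aNonZero-zero (suc Q)) (aNonZero-zero (suc Q))) ⟩
    ℕ→ℚ Q * aNonZero (suc Q) 0 + (1ℚ - aNonZero (suc Q) 0) ∎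
    where
    open ≡-Reasoning
    w = invℕ (suc Q)
    ℤ-identity′ : ∀ x → x ℤ.* + 1 ℤ.- (ℤ.- + 1) ℤ.* + 1 ≡ + 1 ℤ.+ x
    ℤ-identity′ = ℤ-Solver.solve-∀
    ℚ-identity′ : ∀ x → x * 0ℚ + (1ℚ - 0ℚ) ≡ 1ℚ
    ℚ-identity′ = ℚ-Solver.solve-∀ ℚ-ring
  aNonZero-suc Q (suc m) = begin
    w * ℤ→ℚ (q′ ℤ.* (q′ ℤ.* P) ℤ.- (ℤ.- + 1) ℤ.* ((ℤ.- + 1) ℤ.* S))
      ≡⟨ cong (λ z → w * ℤ→ℚ z) (ℤ-identity q′ P S) ⟩
    w * ℤ→ℚ (q′ ℤ.* X₁ ℤ.+ (q′ ℤ.* X₀ ℤ.- X₁))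
      ≡⟨ cong (w *_) (trans (ℤ→ℚ-homo-+ (q′ ℤ.* X₁) _)
                            (cong₂ _+_ (ℤ→ℚ-homo-* q′ X₁)
                                       (trans (ℤ→ℚ-homo-− (q′ ℤ.* X₀) X₁) (cong (_- ℤ→ℚ X₁) (ℤ→ℚ-homo-* q′ X₀))))) ⟩
    w * (ℕ→ℚ Q * ℤ→ℚ X₁ + (ℕ→ℚ Q * ℤ→ℚ X₀ - ℤ→ℚ X₁))
      ≡⟨ ℚ-identity w (ℕ→ℚ Q) (ℤ→ℚ X₁) (ℤ→ℚ X₀) ⟩
    ℕ→ℚ Q * (w * ℤ→ℚ X₁) + (ℕ→ℚ Q * w * ℤ→ℚ X₀ - w * ℤ→ℚ X₁) ∎
    where
    open ≡-Reasoning
    w = invℕ (suc Q)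
    q′ = + Q
    P = q′ ℤ.^ m
    S = (ℤ.- + 1) ℤ.^ m
    X₁ = q′ ℤ.* P ℤ.- (ℤ.- + 1) ℤ.* S
    X₀ = P ℤ.- S
    ℤ-identity : ∀ x P S → x ℤ.* (x ℤ.* P) ℤ.- (ℤ.- + 1) ℤ.* ((ℤ.- + 1) ℤ.* S)
               ≡ x ℤ.* (x ℤ.* P ℤ.- (ℤ.- + 1) ℤ.* S) ℤ.+ (x ℤ.* (P ℤ.- S) ℤ.- (x ℤ.* P ℤ.- (ℤ.- + 1) ℤ.* S))
    ℤ-identity = ℤ-Solver.solve-∀
    ℚ-identity : ∀ w x y z → w * (x * y + (x * z - y)) ≡ x * (w * y) + (x * w * z - w * y)
    ℚ-identity = ℚ-Solver.solve-∀ ℚ-ring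

module MultinomialExpansion where

  open import Data.Rational using (_+_; _*_)
  open RationalCasts
  open Binomials using (C-factorials)
  open ℚSums

  ∏ : ∀ {m} → (Fin m → ℕ → ℚ) → Vec ℕ m → ℚ
  ∏ f rs = Vec.foldr _ _*_ 1ℚ (Vec.tabulate (λ i → f i (Vec.lookup rs i)))

  -- ∑_{r₁ + ⋯ + r_m = r} (r choose r₁, …, r_m) ∏ᵢ fᵢ(rᵢ), computed coordinate by coordinate
  convolve : (m : ℕ) → ℕ → (Fin m → ℕ → ℚ) → ℚ
  convolve zero    zero    f = 1ℚ
  convolve zero    (suc r) f = 0ℚ
  convolve (suc m) r       f = conv r (f Fin.zero) (λ s → convolve m s (f ∘ Fin.suc))

  multinomial-cons : ∀ {m r r₁} (rs : Vec ℕ m) → r₁ ≤ r →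
                     multinomial r (r₁ ∷ rs) ≡ (r C r₁) · 1ℚ * multinomial (r ∸ r₁) rs
  multinomial-cons {m} {r} {r₁} rs r₁≤r = begin
    ℕ→ℚ (r !) * (invℕ (r₁ !) * P)
      ≡⟨ cong (λ x → x * (invℕ (r₁ !) * P))
              (trans (cong ℕ→ℚ (sym (C-factorials r₁≤r)))
                     (trans (ℕ→ℚ-homo-* (r C r₁) _) (cong (ℕ→ℚ (r C r₁) *_) (ℕ→ℚ-homo-* (r₁ !) ((r ∸ r₁) !))))) ⟩
    ℕ→ℚ (r C r₁) * (ℕ→ℚ (r₁ !) * ℕ→ℚ ((r ∸ r₁) !)) * (invℕ (r₁ !) * P)
      ≡⟨ regroup (ℕ→ℚ (r C r₁)) (ℕ→ℚ (r₁ !)) (ℕ→ℚ ((r ∸ r₁) !)) (invℕ (r₁ !)) P ⟩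
    ℕ→ℚ (r C r₁) * (ℕ→ℚ (r₁ !) * invℕ (r₁ !)) * (ℕ→ℚ ((r ∸ r₁) !) * P)
      ≡⟨ cong (λ x → ℕ→ℚ (r C r₁) * x * (ℕ→ℚ ((r ∸ r₁) !) * P)) (ℕ→ℚ*invℕ≡1 (r₁ !) {{ℕ._!≢0 r₁}}) ⟩
    ℕ→ℚ (r C r₁) * 1ℚ * multinomial (r ∸ r₁) rs
      ≡⟨ cong (_* multinomial (r ∸ r₁) rs) (sym (ℕ→ℚ-× (r C r₁) 1ℚ)) ⟩
    (r C r₁) · 1ℚ * multinomial (r ∸ r₁) rs ∎
    where
    open ≡-Reasoning
    P = Vec.foldr _ (λ rᵢ acc → invℕ (rᵢ !) * acc) 1ℚ rs
    regroup : ∀ c x y x⁻¹ P → c * (x * y) * (x⁻¹ * P) ≡ c * (x * x⁻¹) * (y * P)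
    regroup = ℚ-Solver.solve-∀ ℚ-ring

  multinomial-expansion : ∀ m r (f : Fin m → ℕ → ℚ) →
    List.foldr _+_ 0ℚ (List.map (λ rs → multinomial r rs * ∏ f rs) (compositions m r)) ≡ convolve m r f
  multinomial-expansion zero    zero    f = refl
  multinomial-expansion zero    (suc r) f = refl
  multinomial-expansion (suc m) r       f = begin
    List.foldr _+_ 0ℚ (List.map term (List.concatMap prefix (List.upTo (suc r))))
      ≡⟨ foldr-map≡∑ˡ (List.concatMap prefix (List.upTo (suc r))) term ⟩
    ∑ˡ (List.concatMap prefix (List.upTo (suc r))) term
      ≡⟨ ∑ˡ-concatMap prefix (List.upTo (suc r)) term ⟩
    ∑ˡ (List.upTo (suc r)) (λ r₁ → ∑ˡ (prefix r₁) term)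
      ≡⟨ ∑ˡ-applyUpTo (suc r) (λ r₁ → r₁) (λ r₁ → ∑ˡ (prefix r₁) term) ⟩
    ∑< (suc r) (λ r₁ → ∑ˡ (prefix r₁) term)
      ≡⟨ ∑<-cong (suc r) (λ r₁ r₁<1+r → first-coordinate r₁ (ℕ.≤-pred r₁<1+r)) ⟩
    convolve (suc m) r f ∎
    where
    open ≡-Reasoning
    term = λ rs → multinomial r rs * ∏ f rs
    prefix = λ r₁ → List.map (r₁ ∷_) (compositions m (r ∸ r₁))
    first-coordinate : ∀ r₁ → r₁ ≤ r →
      ∑ˡ (prefix r₁) term ≡ (r C r₁) · 1ℚ * (f Fin.zero r₁ * convolve m (r ∸ r₁) (f ∘ Fin.suc))
    first-coordinate r₁ r₁≤r = begin
      ∑ˡ (prefix r₁) term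
        ≡⟨ ∑ˡ-map (r₁ ∷_) (compositions m (r ∸ r₁)) term ⟩
      ∑ˡ (compositions m (r ∸ r₁)) (λ rs → term (r₁ ∷ rs))
        ≡⟨ ∑ˡ-cong (compositions m (r ∸ r₁)) (λ rs → trans (cong (_* ∏ f (r₁ ∷ rs)) (multinomial-cons rs r₁≤r))
                                                          (regroup c _ (f Fin.zero r₁) (∏ (f ∘ Fin.suc) rs))) ⟩
      ∑ˡ (compositions m (r ∸ r₁)) (λ rs → c * (f Fin.zero r₁ * term′ rs))
        ≡⟨ sym (trans (cong (c *_) (*-distribˡ-∑ˡ (compositions m (r ∸ r₁)) (f Fin.zero r₁) term′))
                      (*-distribˡ-∑ˡ (compositions m (r ∸ r₁)) c (λ rs → f Fin.zero r₁ * term′ rs))) ⟩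
      c * (f Fin.zero r₁ * ∑ˡ (compositions m (r ∸ r₁)) term′)
        ≡⟨ cong (λ x → c * (f Fin.zero r₁ * x))
                (trans (sym (foldr-map≡∑ˡ (compositions m (r ∸ r₁)) term′)) (multinomial-expansion m (r ∸ r₁) (f ∘ Fin.suc))) ⟩
      c * (f Fin.zero r₁ * convolve m (r ∸ r₁) (f ∘ Fin.suc)) ∎
      where
      c = (r C r₁) · 1ℚ
      term′ = λ rs → multinomial (r ∸ r₁) rs * ∏ (f ∘ Fin.suc) rs
      regroup : ∀ c M x P → c * M * (x * P) ≡ c * (x * (M * P))
      regroup = ℚ-Solver.solve-∀ ℚ-ring

module FieldProperties (F : FiniteField) where

  open Binomials using (prime∣C)

  open FiniteField F public

  commutativeRing : CommutativeRing 0ℓ 0ℓ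
  commutativeRing = record { isCommutativeRing = isCommutativeRing }

  open CommutativeRing commutativeRing public
    using (_-_; +-assoc; +-comm; +-identityˡ; +-identityʳ; *-assoc; *-comm; *-identityˡ; *-identityʳ;
           distribˡ; distribʳ; zeroˡ; zeroʳ; -‿inverseˡ; -‿inverseʳ; isCommutativeSemiring; ring; +-group)
  open import Algebra.Properties.Ring ring public using (-‿distribˡ-*; -‿distribʳ-*)
  open import Algebra.Properties.Group +-group public
    using () renaming (x∙y⁻¹≈ε⇒x≈y to x-y≡0⇒x≡y; inverseʳ-unique to x+y≡0⇒y≡-x; ∙-cancelˡ to +-cancelˡ)
  open import Algebra.Properties.Group +-group using (x≈z//y; //-rightDividesˡ)
  open SemiringSums isCommutativeSemiring public
  open import Algebra.Properties.Semiring.Mult (CommutativeRing.semiring commutativeRing) public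
    using (×1-homo-*)

  open import Algebra.Properties.CommutativeSemigroup (CommutativeRing.*-commutativeSemigroup commutativeRing)
    using (x∙yz≈y∙xz) renaming (interchange to *-interchange)
  open import Algebra.Solver.Ring.NaturalCoefficients.Default (CommutativeRing.commutativeSemiring commutativeRing)
    using (solve; _:+_; _:*_; _:=_)

  x+y≡z⇒y≡z-x : ∀ {x y z} → x + y ≡ z → y ≡ z - x
  x+y≡z⇒y≡z-x {x} {y} {z} eq = x≈z//y y x z (trans (+-comm y x) eq)

  y≡z-x⇒x+y≡z : ∀ {x y z} → y ≡ z - x → x + y ≡ z
  y≡z-x⇒x+y≡z {x} {y} {z} eq = trans (+-comm x y) (trans (cong (_+ x) eq) (//-rightDividesˡ x z))

  sumFin≡∑ : ∀ n (f : Fin n → Carrier) → sumFin n f ≡ ∑[ i < n ] f i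
  sumFin≡∑ zero    f = refl
  sumFin≡∑ (suc n) f = cong (f Fin.zero +_) (sumFin≡∑ n (f ∘ Fin.suc))

  ^-homo-* : ∀ x m n → x ^ (m ℕ.+ n) ≡ x ^ m * x ^ n
  ^-homo-* x zero    n = sym (*-identityˡ _)
  ^-homo-* x (suc m) n = trans (cong (x *_) (^-homo-* x m n)) (sym (*-assoc x _ _))

  ^-*-assoc : ∀ x m n → (x ^ m) ^ n ≡ x ^ (m ℕ.* n)
  ^-*-assoc x m zero    = cong (x ^_) (sym (ℕ.*-zeroʳ m))
  ^-*-assoc x m (suc n) = trans (cong (x ^ m *_) (^-*-assoc x m n))
                                (trans (sym (^-homo-* x m (m ℕ.* n))) (cong (x ^_) (sym (ℕ.*-suc m n))))

  ^-distrib-* : ∀ x y n → (x * y) ^ n ≡ x ^ n * y ^ n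
  ^-distrib-* x y zero    = sym (*-identityˡ 1#)
  ^-distrib-* x y (suc n) = trans (cong (x * y *_) (^-distrib-* x y n)) (*-interchange x y (x ^ n) (y ^ n))

  1^n≡1 : ∀ n → 1# ^ n ≡ 1#
  1^n≡1 zero    = refl
  1^n≡1 (suc n) = trans (*-identityˡ _) (1^n≡1 n)

  0^n≡0 : ∀ n → 0 < n → 0# ^ n ≡ 0#
  0^n≡0 (suc n) _ = zeroˡ _

  ×1-homo-^ : ∀ m e → (m ℕ.^ e) · 1# ≡ (m · 1#) ^ e
  ×1-homo-^ m zero    = +-identityʳ 1#
  ×1-homo-^ m (suc e) = trans (×1-homo-* m (m ℕ.^ e)) (cong (m · 1# *_) (×1-homo-^ m e))

  zero-product : ∀ x y → x * y ≡ 0# → x ≡ 0# ⊎ y ≡ 0#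
  zero-product x y xy≡0 with x ≟ 0# | inverse x
  ... | yes x≡0 | _   = inj₁ x≡0
  ... | no  x≢0 | inv with inv x≢0
  ...   | x⁻¹ , xx⁻¹≡1 = inj₂ (begin
    y                ≡⟨ sym (*-identityˡ y) ⟩
    1# * y           ≡⟨ cong (_* y) (trans (sym xx⁻¹≡1) (*-comm x x⁻¹)) ⟩
    x⁻¹ * x * y      ≡⟨ *-assoc x⁻¹ x y ⟩
    x⁻¹ * (x * y)    ≡⟨ cong (x⁻¹ *_) xy≡0 ⟩
    x⁻¹ * 0#         ≡⟨ zeroʳ x⁻¹ ⟩
    0#               ∎)
    where open ≡-Reasoning

  *-nonzero : ∀ {x y} → x ≢ 0# → y ≢ 0# → x * y ≢ 0#
  *-nonzero {x} {y} x≢0 y≢0 xy≡0 with zero-product x y xy≡0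
  ... | inj₁ x≡0 = x≢0 x≡0
  ... | inj₂ y≡0 = y≢0 y≡0

  ^-nonzero : ∀ {x} n → x ≢ 0# → x ^ n ≢ 0#
  ^-nonzero zero    x≢0 = 0≢1 ∘ sym
  ^-nonzero (suc n) x≢0 = *-nonzero x≢0 (^-nonzero n x≢0)

  ^≡0⇒≡0 : ∀ {x} n → x ^ n ≡ 0# → x ≡ 0#
  ^≡0⇒≡0 {x} n xⁿ≡0 with x ≟ 0#
  ... | yes x≡0 = x≡0
  ... | no  x≢0 = ⊥-elim (^-nonzero n x≢0 xⁿ≡0)

  *-cancelˡ : ∀ {x} y z → x ≢ 0# → x * y ≡ x * z → y ≡ z
  *-cancelˡ {x} y z x≢0 xy≡xz with zero-product x (y - z) x[y-z]≡0
    where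
    x[y-z]≡0 : x * (y - z) ≡ 0#
    x[y-z]≡0 = trans (distribˡ x y (- z)) (trans (cong₂ _+_ xy≡xz (sym (-‿distribʳ-* x z))) (-‿inverseʳ (x * z)))
  ... | inj₁ x≡0   = ⊥-elim (x≢0 x≡0)
  ... | inj₂ y-z≡0 = x-y≡0⇒x≡y y z y-z≡0

  coordinates-updateAt : ∀ m (u w : Fin m → Carrier) i s →
    sumFin m (λ j → updateAt u i (_- s) j * w j) ≡ sumFin m (λ j → u j * w j) - s * w i
  coordinates-updateAt (suc m) u w Fin.zero s = begin
    (u₀ - s) * w₀ + R                 ≡⟨ cong (_+ R) (distribʳ w₀ u₀ (- s)) ⟩
    u₀ * w₀ + - s * w₀ + R            ≡⟨ swap (u₀ * w₀) (- s * w₀) R ⟩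
    u₀ * w₀ + R + - s * w₀            ≡⟨ cong (u₀ * w₀ + R +_) (sym (-‿distribˡ-* s w₀)) ⟩
    u₀ * w₀ + R - s * w₀              ∎
    where
    open ≡-Reasoning
    u₀ = u Fin.zero
    w₀ = w Fin.zero
    R = sumFin m (λ j → u (Fin.suc j) * w (Fin.suc j))
    swap : ∀ x y z → x + y + z ≡ x + z + y
    swap = solve 3 (λ x y z → x :+ y :+ z := x :+ z :+ y) refl
  coordinates-updateAt (suc m) u w (Fin.suc i) s =
    trans (cong (u Fin.zero * w Fin.zero +_) (coordinates-updateAt m (u ∘ Fin.suc) (w ∘ Fin.suc) i s))
          (sym (+-assoc (u Fin.zero * w Fin.zero) _ (- (s * w (Fin.suc i)))))

  module Enumeration {n : ℕ} (size≡1+n : size ≡ suc n) where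

    enumeration : Fin (suc n) ↔ Carrier
    enumeration = subst (λ m → Fin m ↔ Carrier) size≡1+n enum

    element : Fin (suc n) → Carrier
    element = Inverse.to enumeration

    index : Carrier → Fin (suc n)
    index = Inverse.from enumeration

    element-index : ∀ x → element (index x) ≡ x
    element-index = Inverse.strictlyInverseˡ enumeration

    index-element : ∀ i → index (element i) ≡ i
    index-element = Inverse.strictlyInverseʳ enumeration

    element-injective : ∀ {i j} → element i ≡ element j → i ≡ j
    element-injective {i} {j} eq = trans (sym (index-element i)) (trans (cong index eq) (index-element j))

    index-injective : ∀ {x y} → index x ≡ index y → x ≡ y
    index-injective {x} {y} eq = trans (sym (element-index x)) (trans (cong element eq) (element-index y))

  -- translation by y permutes the elements, so adding y to each of them leaves their sum unchanged
  size·y≡0 : ∀ y → size · y ≡ 0#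
  size·y≡0 y = +-cancelˡ (sum e) (size · y) 0# (begin
    sum e + size · y                ≡⟨ cong (sum e +_) (sym (sum-replicate size)) ⟩
    sum e + ∑[ i < size ] y         ≡⟨ sym (∑-distrib-+ e (λ _ → y)) ⟩
    ∑[ i < size ] (e i + y)         ≡⟨ sum-cong-≗ (λ i → sym (Inverse.strictlyInverseˡ enum (e i + y))) ⟩
    ∑[ i < size ] e (π ⟨$⟩ʳ i)      ≡⟨ sym (∑-permute e π) ⟩
    sum e                           ≡⟨ sym (+-identityʳ _) ⟩
    sum e + 0#                      ∎)
    where
    open ≡-Reasoning
    e = Inverse.to enum
    shift : Carrier ↔ Carrier
    shift = mk↔ₛ′ (_+ y) (_- y)
      (λ x → trans (+-assoc x (- y) y) (trans (cong (x +_) (-‿inverseˡ y)) (+-identityʳ x)))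
      (λ x → trans (+-assoc x y (- y)) (trans (cong (x +_) (-‿inverseʳ y)) (+-identityʳ x)))
    π : Permutation size size
    π = ↔-sym enum ↔-∘ (shift ↔-∘ enum)

  binomial : ∀ m x y → (x + y) ^ m ≡ conv m (x ^_) (y ^_)
  binomial zero    x y = sym (trans (+-identityˡ _) (trans (cong (_* (1# * 1#)) (+-identityʳ 1#))
                                                          (trans (*-identityˡ _) (*-identityˡ 1#))))
  binomial (suc m) x y = begin
    (x + y) * (x + y) ^ m
      ≡⟨ cong ((x + y) *_) (binomial m x y) ⟩
    (x + y) * conv m (x ^_) (y ^_)
      ≡⟨ distribʳ _ x y ⟩
    x * conv m (x ^_) (y ^_) + y * conv m (x ^_) (y ^_)
      ≡⟨ sym (cong₂ _+_ (conv-*ˡ m x (x ^_) (y ^_)) (conv-*ʳ m y (x ^_) (y ^_))) ⟩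
    conv m (λ i → x ^ suc i) (y ^_) + conv m (x ^_) (λ i → y ^ suc i)
      ≡⟨ sym (conv-suc m (x ^_) (y ^_)) ⟩
    conv (suc m) (x ^_) (y ^_)                          ∎
    where open ≡-Reasoning

  ^p-distrib-+ : ∀ {p} .{{_ : ℕ.NonZero p}} → Prime p → p · 1# ≡ 0# → ∀ x y → (x + y) ^ p ≡ x ^ p + y ^ p
  ^p-distrib-+ {suc p′} p-prime p·1≡0 x y = begin
    (x + y) ^ suc p′                          ≡⟨ binomial (suc p′) x y ⟩
    ∑< (suc p′) t + t (suc p′)                ≡⟨ cong (_+ t (suc p′)) (∑<-head p′ t) ⟩
    t 0 + ∑< p′ (t ∘ suc) + t (suc p′)        ≡⟨ cong₂ (λ a b → a + b + t (suc p′)) first middle ⟩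
    y ^ suc p′ + 0# + t (suc p′)              ≡⟨ cong₂ _+_ (+-identityʳ _) last ⟩
    y ^ suc p′ + x ^ suc p′                   ≡⟨ +-comm _ _ ⟩
    x ^ suc p′ + y ^ suc p′                   ∎
    where
    open ≡-Reasoning
    t = λ i → (suc p′ C i) · 1# * (x ^ i * y ^ (suc p′ ∸ i))
    first : t 0 ≡ y ^ suc p′
    first = trans (cong (_* (1# * y ^ suc p′)) (+-identityʳ 1#)) (trans (*-identityˡ _) (*-identityˡ _))
    p∣m⇒m·1≡0 : ∀ {m} → suc p′ ∣ m → m · 1# ≡ 0#
    p∣m⇒m·1≡0 (divides c refl) = trans (×1-homo-* c (suc p′)) (trans (cong (c · 1# *_) p·1≡0) (zeroʳ _))
    middle : ∑< p′ (t ∘ suc) ≡ 0#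
    middle = ∑<-zero p′ λ i i<p′ →
      trans (cong (_* (x ^ suc i * y ^ (suc p′ ∸ suc i))) (p∣m⇒m·1≡0 (prime∣C p-prime (s≤s z≤n) (s≤s i<p′)))) (zeroˡ _)
    last : t (suc p′) ≡ x ^ suc p′
    last = trans (cong₂ (λ c m → c · 1# * (x ^ suc p′ * y ^ m)) (nCn≡1 (suc p′)) (ℕ.n∸n≡0 p′))
                 (trans (cong (_* (x ^ suc p′ * 1#)) (+-identityʳ 1#))
                        (trans (*-identityˡ _) (*-identityʳ _)))

  module Frobenius {p E : ℕ} (p-prime : Prime p) (size≡pᴱ : size ≡ p ℕ.^ E) where

    private instance
      p≢0 : ℕ.NonZero p
      p≢0 = prime⇒nonZero p-prime

    characteristic : p · 1# ≡ 0#
    characteristic = ^≡0⇒≡0 E (trans (sym (×1-homo-^ p E)) (trans (cong (_· 1#) (sym size≡pᴱ)) (size·y≡0 1#)))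

    private
      0<pᵉ : ∀ e → 0 < p ℕ.^ e
      0<pᵉ e = ℕ.m^n>0 p e

    frobenius-+ : ∀ e x y → (x + y) ^ (p ℕ.^ e) ≡ x ^ (p ℕ.^ e) + y ^ (p ℕ.^ e)
    frobenius-+ zero    x y = trans (*-identityʳ _) (cong₂ _+_ (sym (*-identityʳ x)) (sym (*-identityʳ y)))
    frobenius-+ (suc e) x y = begin
      (x + y) ^ (p ℕ.* p ℕ.^ e)
        ≡⟨ sym (^-*-assoc (x + y) p (p ℕ.^ e)) ⟩
      ((x + y) ^ p) ^ (p ℕ.^ e)
        ≡⟨ cong (_^ (p ℕ.^ e)) (^p-distrib-+ p-prime characteristic x y) ⟩
      (x ^ p + y ^ p) ^ (p ℕ.^ e)
        ≡⟨ frobenius-+ e (x ^ p) (y ^ p) ⟩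
      (x ^ p) ^ (p ℕ.^ e) + (y ^ p) ^ (p ℕ.^ e)
        ≡⟨ cong₂ _+_ (^-*-assoc x p (p ℕ.^ e)) (^-*-assoc y p (p ℕ.^ e)) ⟩
      x ^ (p ℕ.* p ℕ.^ e) + y ^ (p ℕ.* p ℕ.^ e) ∎
      where open ≡-Reasoning

    frobenius-− : ∀ e x y → (x - y) ^ (p ℕ.^ e) ≡ x ^ (p ℕ.^ e) - y ^ (p ℕ.^ e)
    frobenius-− e x y = trans (frobenius-+ e x (- y)) (cong (x ^ (p ℕ.^ e) +_) frobenius-‿-)
      where
      frobenius-‿- : (- y) ^ (p ℕ.^ e) ≡ - (y ^ (p ℕ.^ e))
      frobenius-‿- = x+y≡0⇒y≡-x _ _ (trans (sym (frobenius-+ e y (- y)))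
                                           (trans (cong (_^ (p ℕ.^ e)) (-‿inverseʳ y)) (0^n≡0 _ (0<pᵉ e))))

    frobenius-∑ : ∀ e n (f : Fin n → Carrier) → (∑[ i < n ] f i) ^ (p ℕ.^ e) ≡ ∑[ i < n ] (f i ^ (p ℕ.^ e))
    frobenius-∑ e zero    f = 0^n≡0 _ (0<pᵉ e)
    frobenius-∑ e (suc n) f = trans (frobenius-+ e _ _) (cong (f Fin.zero ^ (p ℕ.^ e) +_) (frobenius-∑ e n (f ∘ Fin.suc)))

    frobenius-injective : ∀ e {x y} → x ^ (p ℕ.^ e) ≡ y ^ (p ℕ.^ e) → x ≡ y
    frobenius-injective e {x} {y} eq =
      x-y≡0⇒x≡y x y (^≡0⇒≡0 (p ℕ.^ e) (trans (frobenius-− e x y) (trans (cong (_- y ^ (p ℕ.^ e)) eq) (-‿inverseʳ _))))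

  module PrimitiveElement {n : ℕ} (size≡1+n : size ≡ suc n) (2≤n : 2 ≤ n)
                          (ω : Carrier) (ω-primitive : IsPrimitiveElement ω) where

    open Enumeration size≡1+n

    code : ∀ x → x ≢ 0# → Fin n
    code x x≢0 = Fin.punchOut {i = index 0#} {j = index x} (x≢0 ∘ sym ∘ index-injective)

    code-injective : ∀ {x y} (x≢0 : x ≢ 0#) (y≢0 : y ≢ 0#) → code x x≢0 ≡ code y y≢0 → x ≡ y
    code-injective x≢0 y≢0 eq =
      index-injective (Fin.punchOut-injective (x≢0 ∘ sym ∘ index-injective) (y≢0 ∘ sym ∘ index-injective) eq)

    decode : Fin n → Carrier
    decode i = element (Fin.punchIn (index 0#) i)

    decode-nonzero : ∀ i → decode i ≢ 0#
    decode-nonzero i eq = Fin.punchInᵢ≢i (index 0#) i (trans (sym (index-element _)) (cong index eq))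

    decode-injective : ∀ {i j} → decode i ≡ decode j → i ≡ j
    decode-injective eq = Fin.punchIn-injective (index 0#) _ _ (element-injective eq)

    log : Fin n → ℕ
    log i = proj₁ (ω-primitive (decode i) (decode-nonzero i))

    private
      nonzero⇒≡1 : ω ≡ 0# → ∀ {x} → x ≢ 0# → x ≡ 1#
      nonzero⇒≡1 ω≡0 {x} x≢0 with ω-primitive x x≢0
      ... | zero  , 1≡x    = sym 1≡x
      ... | suc j , ωʲ⁺¹≡x = ⊥-elim (x≢0 (trans (sym ωʲ⁺¹≡x) (trans (cong (_* ω ^ j) ω≡0) (zeroˡ _))))

      isZero : Fin (suc n) → Fin 2
      isZero i = if isYes (element i ≟ 0#) then Fin.zero else Fin.suc Fin.zero

      isZero-injective : ω ≡ 0# → ∀ {i j} → isZero i ≡ isZero j → element i ≡ element j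
      isZero-injective ω≡0 {i} {j} eq with element i ≟ 0# | element j ≟ 0#
      ... | yes i≡0 | yes j≡0 = trans i≡0 (sym j≡0)
      ... | no  i≢0 | no  j≢0 = trans (nonzero⇒≡1 ω≡0 i≢0) (sym (nonzero⇒≡1 ω≡0 j≢0))

    -- if ω were 0, every element would be 0 or 1
    ω≢0 : ω ≢ 0#
    ω≢0 ω≡0 with Fin.pigeonhole (s≤s 2≤n) isZero
    ... | i , j , i<j , same = Fin.<-irrefl (element-injective (isZero-injective ω≡0 same)) i<j

    ω^-nonzero : ∀ j → ω ^ j ≢ 0#
    ω^-nonzero j = ^-nonzero j ω≢0

    ω^-cancel : ∀ {i j} → i ≤ j → ω ^ i ≡ ω ^ j → ω ^ (j ∸ i) ≡ 1#
    ω^-cancel {i} {j} i≤j eq = sym (*-cancelˡ 1# (ω ^ (j ∸ i)) (ω^-nonzero i)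
      (trans (*-identityʳ _) (trans eq (trans (cong (ω ^_) (sym (ℕ.m+[n∸m]≡n i≤j))) (^-homo-* ω i (j ∸ i))))))

    ω^-mod : ∀ d .{{_ : ℕ.NonZero d}} → ω ^ d ≡ 1# → ∀ m → ω ^ m ≡ ω ^ (m % d)
    ω^-mod d ωᵈ≡1 m = begin
      ω ^ m
        ≡⟨ cong (ω ^_) (trans (m≡m%n+[m/n]*n m d) (cong (m % d ℕ.+_) (ℕ.*-comm (m / d) d))) ⟩
      ω ^ (m % d ℕ.+ d ℕ.* (m / d))
        ≡⟨ ^-homo-* ω (m % d) _ ⟩
      ω ^ (m % d) * ω ^ (d ℕ.* (m / d))
        ≡⟨ cong (ω ^ (m % d) *_) (trans (sym (^-*-assoc ω d (m / d)))
                                       (trans (cong (_^ (m / d)) ωᵈ≡1) (1^n≡1 (m / d)))) ⟩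
      ω ^ (m % d) * 1#
        ≡⟨ *-identityʳ _ ⟩
      ω ^ (m % d)                     ∎
      where open ≡-Reasoning

    -- n + 1 powers of ω among the n nonzero elements: two coincide
    short-period : ∃ λ d → 0 < d × d ≤ n × ω ^ d ≡ 1#
    short-period with Fin.pigeonhole (ℕ.n<1+n n) (λ j → code (ω ^ toℕ j) (ω^-nonzero (toℕ j)))
    ... | i , j , i<j , same =
      toℕ j ∸ toℕ i , ℕ.m<n⇒0<n∸m i<j , ℕ.≤-trans (ℕ.m∸n≤m (toℕ j) (toℕ i)) (ℕ.≤-pred (Fin.toℕ<n j)) ,
      ω^-cancel (ℕ.<⇒≤ i<j) (code-injective (ω^-nonzero (toℕ i)) (ω^-nonzero (toℕ j)) same)

    -- the n nonzero elements are powers of ω, but only d distinct powers exist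
    period-≥ : ∀ {d} → 0 < d → ω ^ d ≡ 1# → n ≤ d
    period-≥ {d} 0<d ωᵈ≡1 with ℕ.<-cmp d n
    ... | tri> _ _ n<d = ℕ.<⇒≤ n<d
    ... | tri≈ _ refl _ = ℕ.≤-refl
    ... | tri< d<n _ _ with Fin.pigeonhole d<n (λ i → Fin.fromℕ< (m%n<n (log i) d {{ℕ.>-nonZero 0<d}}))
    ...   | i , j , i<j , same = ⊥-elim (Fin.<-irrefl (decode-injective (begin
      decode i
        ≡⟨ sym (proj₂ (ω-primitive (decode i) (decode-nonzero i))) ⟩
      ω ^ log i
        ≡⟨ ω^-mod d ωᵈ≡1 (log i) ⟩
      ω ^ (log i % d)
        ≡⟨ cong (ω ^_) (trans (sym (Fin.toℕ-fromℕ< _)) (trans (cong toℕ same) (Fin.toℕ-fromℕ< _))) ⟩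
      ω ^ (log j % d)
        ≡⟨ sym (ω^-mod d ωᵈ≡1 (log j)) ⟩
      ω ^ log j
        ≡⟨ proj₂ (ω-primitive (decode j) (decode-nonzero j)) ⟩
      decode j                  ∎)) i<j)
      where
      open ≡-Reasoning
      instance _ = ℕ.>-nonZero 0<d

    ω^n≡1 : ω ^ n ≡ 1#
    ω^n≡1 with short-period
    ... | d , 0<d , d≤n , ωᵈ≡1 = subst (λ m → ω ^ m ≡ 1#) (ℕ.≤-antisym d≤n (period-≥ 0<d ωᵈ≡1)) ωᵈ≡1

    private instance
      n≢0 : ℕ.NonZero n
      n≢0 = ℕ.>-nonZero (ℕ.<-≤-trans (s≤s z≤n) 2≤n)

    order-∣ : ∀ {m} → ω ^ m ≡ 1# → n ∣ m
    order-∣ {m} ωᵐ≡1 with m % n in m%n≡r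
    ... | zero  = m%n≡0⇒n∣m m n m%n≡r
    ... | suc r = ⊥-elim (ℕ.<⇒≱ (subst (_< n) m%n≡r (m%n<n m n))
                    (period-≥ (s≤s z≤n) (trans (cong (ω ^_) (sym m%n≡r)) (trans (sym (ω^-mod n ω^n≡1 m)) ωᵐ≡1))))

    private
      ω^-injective-≤ : ∀ {i j} → i ≤ j → j < n → ω ^ i ≡ ω ^ j → j ≡ i
      ω^-injective-≤ {i} {j} i≤j j<n eq with j ∸ i in j∸i≡d | ω^-cancel i≤j eq
      ... | zero  | _    = ℕ.≤-antisym (ℕ.m∸n≡0⇒m≤n j∸i≡d) i≤j
      ... | suc d | ωᵈ≡1 = ⊥-elim (ℕ.<⇒≱ (ℕ.≤-<-trans (subst (_≤ j) j∸i≡d (ℕ.m∸n≤m j i)) j<n)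
                                          (period-≥ (s≤s z≤n) ωᵈ≡1))

    ω^-injective : ∀ {i j} → i < n → j < n → ω ^ i ≡ ω ^ j → i ≡ j
    ω^-injective {i} {j} i<n j<n eq with ℕ.≤-total i j
    ... | inj₁ i≤j = sym (ω^-injective-≤ i≤j j<n eq)
    ... | inj₂ j≤i = ω^-injective-≤ j≤i i<n (sym eq)

    discrete-log : ∀ x → x ≢ 0# → ∃ λ m → m < n × ω ^ m ≡ x
    discrete-log x x≢0 with ω-primitive x x≢0
    ... | m , ωᵐ≡x = m % n , m%n<n m n , trans (sym (ω^-mod n ω^n≡1 m)) ωᵐ≡x

  horner : (m : ℕ) → (Fin m → Carrier) → Carrier → Carrier
  horner zero    c x = 0#
  horner (suc m) c x = c Fin.zero + x * horner m (c ∘ Fin.suc) x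

  horner≡∑ : ∀ m c x → horner m c x ≡ ∑[ i < m ] (c i * x ^ toℕ i)
  horner≡∑ zero    c x = refl
  horner≡∑ (suc m) c x = cong₂ _+_ (sym (*-identityʳ _)) (begin
    x * horner m (c ∘ Fin.suc) x
      ≡⟨ cong (x *_) (horner≡∑ m (c ∘ Fin.suc) x) ⟩
    x * ∑[ i < m ] (c (Fin.suc i) * x ^ toℕ i)
      ≡⟨ *-distribˡ-sum x (λ i → c (Fin.suc i) * x ^ toℕ i) ⟩
    ∑[ i < m ] (x * (c (Fin.suc i) * x ^ toℕ i))
      ≡⟨ sum-cong-≗ (λ i → x∙yz≈y∙xz x (c (Fin.suc i)) _) ⟩
    ∑[ i < m ] (c (Fin.suc i) * x ^ suc (toℕ i))      ∎)
    where open ≡-Reasoning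

  -- synthetic division of ∑ cᵢ Xⁱ by X - r
  quotient : (m : ℕ) → (Fin (suc m) → Carrier) → Carrier → Fin m → Carrier
  quotient (suc m) c r Fin.zero    = horner (suc m) (c ∘ Fin.suc) r
  quotient (suc m) c r (Fin.suc i) = quotient m (c ∘ Fin.suc) r i

  -- P(x) = (x - r) Q(x) + P(r), stated without subtraction
  horner-division : ∀ m c x r →
    horner (suc m) c x + r * horner m (quotient m c r) x ≡ x * horner m (quotient m c r) x + horner (suc m) c r
  horner-division zero    c x r = begin
    c Fin.zero + x * 0# + r * 0#  ≡⟨ cong₂ (λ a b → c Fin.zero + a + b) (zeroʳ x) (zeroʳ r) ⟩
    c Fin.zero + 0# + 0#          ≡⟨ trans (+-identityʳ _) (sym (+-identityˡ _)) ⟩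
    0# + (c Fin.zero + 0#)        ≡⟨ sym (cong₂ (λ a b → a + (c Fin.zero + b)) (zeroʳ x) (zeroʳ r)) ⟩
    x * 0# + (c Fin.zero + r * 0#) ∎
    where open ≡-Reasoning
  horner-division (suc m) c x r = begin
    c₀ + x * h + r * (e + x * q)
      ≡⟨ regroup c₀ x h r e q ⟩
    c₀ + r * e + x * (h + r * q)
      ≡⟨ cong (λ t → c₀ + r * e + x * t) (horner-division m (c ∘ Fin.suc) x r) ⟩
    c₀ + r * e + x * (x * q + e)
      ≡⟨ regroup′ c₀ x r e q ⟩
    x * (e + x * q) + (c₀ + r * e) ∎
    where
    open ≡-Reasoning
    c₀ = c Fin.zero
    h = horner (suc m) (c ∘ Fin.suc) x
    e = horner (suc m) (c ∘ Fin.suc) r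
    q = horner m (quotient m (c ∘ Fin.suc) r) x
    regroup : ∀ c₀ x h r e q → c₀ + x * h + r * (e + x * q) ≡ c₀ + r * e + x * (h + r * q)
    regroup = solve 6 (λ c₀ x h r e q → c₀ :+ x :* h :+ r :* (e :+ x :* q) := c₀ :+ r :* e :+ x :* (h :+ r :* q)) refl
    regroup′ : ∀ c₀ x r e q → c₀ + r * e + x * (x * q + e) ≡ x * (e + x * q) + (c₀ + r * e)
    regroup′ = solve 5 (λ c₀ x r e q → c₀ :+ r :* e :+ x :* (x :* q :+ e) := x :* (e :+ x :* q) :+ (c₀ :+ r :* e)) refl

  quotient-zero⇒zero : ∀ m c r → (∀ i → quotient m c r i ≡ 0#) → horner (suc m) c r ≡ 0# → ∀ i → c i ≡ 0#
  quotient-zero⇒zero zero    c r _ root Fin.zero = trans (sym (+-identityʳ _)) (trans (cong (c Fin.zero +_) (sym (zeroʳ r))) root)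
  quotient-zero⇒zero (suc m) c r q≡0 root Fin.zero =
    trans (sym (+-identityʳ _)) (trans (cong (c Fin.zero +_) (sym (trans (cong (r *_) (q≡0 Fin.zero)) (zeroʳ r)))) root)
  quotient-zero⇒zero (suc m) c r q≡0 root (Fin.suc i) =
    quotient-zero⇒zero m (c ∘ Fin.suc) r (q≡0 ∘ Fin.suc) (q≡0 Fin.zero) i

  distinct-roots⇒zero : ∀ m (c ρ : Fin m → Carrier) → (∀ {i j} → ρ i ≡ ρ j → i ≡ j) →
                        (∀ j → horner m c (ρ j) ≡ 0#) → ∀ i → c i ≡ 0#
  distinct-roots⇒zero (suc m) c ρ ρ-injective roots =
    quotient-zero⇒zero m c r (distinct-roots⇒zero m q (ρ ∘ Fin.suc) (Fin.suc-injective ∘ ρ-injective) q-roots) (roots Fin.zero)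
    where
    r = ρ Fin.zero
    q = quotient m c r
    q-roots : ∀ j → horner m q (ρ (Fin.suc j)) ≡ 0#
    q-roots j with horner m q (ρ (Fin.suc j)) ≟ 0#
    ... | yes q[ρⱼ]≡0 = q[ρⱼ]≡0
    ... | no  q[ρⱼ]≢0 with ρ-injective (*-cancelˡ r (ρ (Fin.suc j)) q[ρⱼ]≢0 (begin
      q[ρⱼ] * r                  ≡⟨ *-comm _ r ⟩
      r * q[ρⱼ]                  ≡⟨ sym (+-identityˡ _) ⟩
      0# + r * q[ρⱼ]             ≡⟨ cong (_+ r * q[ρⱼ]) (sym (roots (Fin.suc j))) ⟩
      horner (suc m) c (ρ (Fin.suc j)) + r * q[ρⱼ] ≡⟨ horner-division m c (ρ (Fin.suc j)) r ⟩
      ρ (Fin.suc j) * q[ρⱼ] + horner (suc m) c r  ≡⟨ cong (ρ (Fin.suc j) * q[ρⱼ] +_) (roots Fin.zero) ⟩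
      ρ (Fin.suc j) * q[ρⱼ] + 0# ≡⟨ +-identityʳ _ ⟩
      ρ (Fin.suc j) * q[ρⱼ]      ≡⟨ *-comm _ q[ρⱼ] ⟩
      q[ρⱼ] * ρ (Fin.suc j)      ∎))
      where
      open ≡-Reasoning
      q[ρⱼ] = horner m q (ρ (Fin.suc j))
    ...   | ()

module Counting (F : FiniteField) (k : ℕ) where

  open FieldProperties F

  N : ℕ → Carrier → ℕ
  N r α = numSolutions r k α

  private
    isSolution? : ∀ α {m} (xs : Vec Carrier m) → Dec (VAll.All (λ x → x ≢ 0#) xs × sumPow k xs ≡ α)
    isSolution? α xs = VAll.all? (λ x → ¬? (x ≟ 0#)) xs ×-dec (sumPow k xs ≟ α)

    indicator : Carrier → ∀ {m} → Vec Carrier m → ℕ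
    indicator α xs = if does (isSolution? α xs) then 1 else 0

    does-⇔ : ∀ {P R : Set} (P? : Dec P) (R? : Dec R) → (P → R) → (R → P) → does P? ≡ does R?
    does-⇔ (yes p) R? P⇒R R⇒P = sym (dec-true R? (P⇒R p))
    does-⇔ (no ¬p) R? P⇒R R⇒P = sym (dec-false R? (¬p ∘ R⇒P))

    indicator-∷ : ∀ α x {m} (xs : Vec Carrier m) →
                  indicator α (x ∷ xs) ≡ (if does (x ≟ 0#) then 0 else indicator (α - x ^ k) xs)
    indicator-∷ α x xs =
      trans (cong (λ d → if (not (does (x ≟ 0#)) ∧ does (VAll.all? (λ y → ¬? (y ≟ 0#)) xs)) ∧ d then 1 else 0)
                  (does-⇔ ((x ^ k + sumPow k xs) ≟ α) (sumPow k xs ≟ (α - x ^ k)) x+y≡z⇒y≡z-x y≡z-x⇒x+y≡z))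
            (case-x≟0 (does (x ≟ 0#)))
      where
      case-x≟0 : ∀ d₀ {d₁ d₂} → (if (not d₀ ∧ d₁) ∧ d₂ then 1 else 0) ≡ (if d₀ then 0 else (if d₁ ∧ d₂ then 1 else 0))
      case-x≟0 true  = refl
      case-x≟0 false = refl

  N≡∑ˡ : ∀ r α → N r α ≡ ℕSums.∑ˡ (allTuples r) (indicator α)
  N≡∑ˡ r α = ℕSums.length-filter (isSolution? α) (allTuples r)

  N-zero : ∀ α → N 0 α ≡ (if does (0# ≟ α) then 1 else 0)
  N-zero α = trans (N≡∑ˡ 0 α) (ℕ.+-identityʳ _)

  N-suc : ∀ r α → N (suc r) α ≡ ℕSums.∑ˡ elements (λ x → if does (x ≟ 0#) then 0 else N r (α - x ^ k))
  N-suc r α = begin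
    N (suc r) α
      ≡⟨ N≡∑ˡ (suc r) α ⟩
    ℕSums.∑ˡ (List.concatMap prefix elements) (indicator α)
      ≡⟨ ℕSums.∑ˡ-concatMap prefix elements (indicator α) ⟩
    ℕSums.∑ˡ elements (λ x → ℕSums.∑ˡ (prefix x) (indicator α))
      ≡⟨ ℕSums.∑ˡ-cong elements first-coordinate ⟩
    ℕSums.∑ˡ elements (λ x → if does (x ≟ 0#) then 0 else N r (α - x ^ k)) ∎
    where
    open ≡-Reasoning
    prefix = λ x → List.map (x ∷_) (allTuples r)
    ∑ˡ-if : ∀ {X : Set} (xs : List X) d (f : X → ℕ) →
            ℕSums.∑ˡ xs (λ x → if d then 0 else f x) ≡ (if d then 0 else ℕSums.∑ˡ xs f)
    ∑ˡ-if []       true  f = refl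
    ∑ˡ-if []       false f = refl
    ∑ˡ-if (x ∷ xs) true  f = ∑ˡ-if xs true f
    ∑ˡ-if (x ∷ xs) false f = cong (f x ℕ.+_) (∑ˡ-if xs false f)
    first-coordinate : ∀ x → ℕSums.∑ˡ (prefix x) (indicator α) ≡ (if does (x ≟ 0#) then 0 else N r (α - x ^ k))
    first-coordinate x = begin
      ℕSums.∑ˡ (prefix x) (indicator α)
        ≡⟨ ℕSums.∑ˡ-map (x ∷_) (allTuples r) (indicator α) ⟩
      ℕSums.∑ˡ (allTuples r) (λ xs → indicator α (x ∷ xs))
        ≡⟨ ℕSums.∑ˡ-cong (allTuples r) (indicator-∷ α x) ⟩
      ℕSums.∑ˡ (allTuples r) (λ xs → if does (x ≟ 0#) then 0 else indicator (α - x ^ k) xs)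
        ≡⟨ ∑ˡ-if (allTuples r) (does (x ≟ 0#)) _ ⟩
      (if does (x ≟ 0#) then 0 else ℕSums.∑ˡ (allTuples r) (indicator (α - x ^ k)))
        ≡⟨ cong (if does (x ≟ 0#) then 0 else_) (sym (N≡∑ˡ r (α - x ^ k))) ⟩
      (if does (x ≟ 0#) then 0 else N r (α - x ^ k))                       ∎

module SumsOverElements (F : FiniteField) {n : ℕ} (size≡1+n : FiniteField.size F ≡ suc n) (2≤n : 2 ≤ n)
                        (ω : FiniteField.Carrier F) (ω-primitive : FiniteField.IsPrimitiveElement F ω) where

  open FieldProperties F hiding (sum-syntax)
  open Enumeration size≡1+n
  open PrimitiveElement size≡1+n 2≤n ω ω-primitive
  open ℚSums using (sum-syntax)

  ∑ˡ-elements : ∀ (G : Carrier → ℚ) → ℚSums.∑ˡ elements G ≡ ∑[ i < suc n ] G (element i)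
  ∑ˡ-elements G = trans (ℚSums.∑ˡ-map (Inverse.to enum) (List.allFin size) G)
                        (trans (ℚSums.∑ˡ-tabulate size (λ i → i) (G ∘ Inverse.to enum)) (transport size≡1+n enum))
    where
    transport : ∀ {m} (eq : m ≡ suc n) (e : Fin m ↔ Carrier) →
                ∑[ i < m ] G (Inverse.to e i) ≡ ∑[ i < suc n ] G (Inverse.to (subst (λ m → Fin m ↔ Carrier) eq e) i)
    transport refl e = refl

  ∑-nonzero≡∑<-powers : ∀ (G : Carrier → ℚ) →
    ∑[ i < suc n ] (if does (element i ≟ 0#) then 0ℚ else G (element i)) ≡ ℚSums.∑< n (λ m → G (ω ^ m))
  ∑-nonzero≡∑<-powers G =
    trans (sym (ℚSums.sum-cong-≗ row)) (trans (ℚSums.∑-comm-∑< (suc n) n (λ i m → δ m i)) (ℚSums.∑<-cong n λ m _ → column m))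
    where
    δ : ℕ → Fin (suc n) → ℚ
    δ m i = if does ((ω ^ m) ≟ element i) then G (ω ^ m) else 0ℚ
    off : ∀ m i → ω ^ m ≢ element i → δ m i ≡ 0ℚ
    off m i ne = cong (if_then G (ω ^ m) else 0ℚ) (dec-false ((ω ^ m) ≟ element i) ne)
    row : ∀ i → ℚSums.∑< n (λ m → δ m i) ≡ (if does (element i ≟ 0#) then 0ℚ else G (element i))
    row i = by-cases (element i ≟ 0#)
      where
      at-log : (∃ λ m → m < n × ω ^ m ≡ element i) → ℚSums.∑< n (λ m → δ m i) ≡ G (element i)
      at-log (m₀ , m₀<n , ωᵐ⁰≡eᵢ) =
        trans (ℚSums.∑<-delta n m₀ m₀<n λ m m<n m≢m₀ → off m i λ eq → m≢m₀ (ω^-injective m<n m₀<n (trans eq (sym ωᵐ⁰≡eᵢ))))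
              (trans (cong (if_then G (ω ^ m₀) else 0ℚ) (dec-true ((ω ^ m₀) ≟ element i) ωᵐ⁰≡eᵢ)) (cong G ωᵐ⁰≡eᵢ))
      by-cases : (d : Dec (element i ≡ 0#)) → ℚSums.∑< n (λ m → δ m i) ≡ (if does d then 0ℚ else G (element i))
      by-cases (yes eᵢ≡0) = ℚSums.∑<-zero n λ m _ → off m i λ eq → ω^-nonzero m (trans eq eᵢ≡0)
      by-cases (no  eᵢ≢0) = at-log (discrete-log (element i) eᵢ≢0)
    column : ∀ m → ∑[ i < suc n ] δ m i ≡ G (ω ^ m)
    column m = trans (ℚSums.∑-delta (suc n) (index (ω ^ m)) λ i i≢ →
                        off m i λ eq → i≢ (trans (sym (index-element i)) (cong index (sym eq))))
                     (cong (if_then G (ω ^ m) else 0ℚ) (dec-true ((ω ^ m) ≟ _) (sym (element-index (ω ^ m)))))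

module Setting (p a b k : ℕ) (p-prime : Prime p) (1≤a : 1 ≤ a) (1<b : 1 < b)
               (k-def : k ℕ.* (b ℕ.* (p ℕ.^ a ∸ 1)) ≡ p ℕ.^ (a ℕ.* b) ∸ 1)
               (primitive-divisor : PrimitiveDivisor p (a ℕ.* b) (b ℕ.* (p ℕ.^ a ∸ 1)))
               (F : FiniteField) (size≡pᵃᵇ : FiniteField.size F ≡ p ℕ.^ (a ℕ.* b))
               (ω : FiniteField.Carrier F) (ω-primitive : FiniteField.IsPrimitiveElement F ω) where

  open FieldProperties F hiding (sum-syntax)
  open RationalCasts
  open Coefficients
  open MultinomialExpansion using (convolve)
  open ℚSums using (sum-syntax)

  q Q n : ℕ
  q = p ℕ.^ a
  Q = q ∸ 1
  n = p ℕ.^ (a ℕ.* b) ∸ 1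

  private instance
    p≢0 : NonZero p
    p≢0 = prime⇒nonZero p-prime

  2≤p : 2 ≤ p
  2≤p = ℕ.nonTrivial⇒n>1 p {{prime⇒nonTrivial p-prime}}

  2≤q : 2 ≤ q
  2≤q = ℕ.≤-trans 2≤p (subst (_≤ q) (ℕ.*-identityʳ p) (ℕ.^-monoʳ-≤ p 1≤a))

  q≡1+Q : q ≡ suc Q
  q≡1+Q = sym (ℕ.m+[n∸m]≡n (ℕ.<⇒≤ 2≤q))

  0<Q : 0 < Q
  0<Q = ℕ.≤-pred (subst (2 ≤_) q≡1+Q 2≤q)

  4≤pᵃᵇ : 4 ≤ p ℕ.^ (a ℕ.* b)
  4≤pᵃᵇ = ℕ.≤-trans (ℕ.*-mono-≤ 2≤p (ℕ.*-mono-≤ 2≤p (s≤s (z≤n {0}))))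
                    (ℕ.^-monoʳ-≤ p (ℕ.*-mono-≤ 1≤a 1<b))

  pᵃᵇ≡1+n : p ℕ.^ (a ℕ.* b) ≡ suc n
  pᵃᵇ≡1+n = sym (ℕ.m+[n∸m]≡n (ℕ.≤-trans (s≤s z≤n) 4≤pᵃᵇ))

  size≡1+n : size ≡ suc n
  size≡1+n = trans size≡pᵃᵇ pᵃᵇ≡1+n

  2≤n : 2 ≤ n
  2≤n = ℕ.≤-pred (ℕ.≤-trans (ℕ.n≤1+n 3) (subst (4 ≤_) pᵃᵇ≡1+n 4≤pᵃᵇ))

  n≡k*b*Q : n ≡ k ℕ.* (b ℕ.* Q)
  n≡k*b*Q = sym k-def

  open Enumeration size≡1+n
  open PrimitiveElement size≡1+n 2≤n ω ω-primitive
  open Frobenius {E = a ℕ.* b} p-prime size≡pᵃᵇ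
  open Counting F k
  open SumsOverElements F size≡1+n 2≤n ω ω-primitive

  private instance
    k≢0 : NonZero k
    k≢0 = ℕ.≢-nonZero λ k≡0 → ℕ.<⇒≱ (ℕ.<-≤-trans (s≤s z≤n) 2≤n) (ℕ.≤-reflexive (trans n≡k*b*Q (cong (ℕ._* (b ℕ.* Q)) k≡0)))
    b≢0 : NonZero b
    b≢0 = ℕ.>-nonZero (ℕ.<-trans (s≤s z≤n) 1<b)
    Q≢0 : NonZero Q
    Q≢0 = ℕ.>-nonZero 0<Q

  InFq : Carrier → Set
  InFq x = x ^ q ≡ x

  InFq-− : ∀ {x y} → InFq x → InFq y → InFq (x - y)
  InFq-− x∈ y∈ = trans (frobenius-− a _ _) (cong₂ _-_ x∈ y∈)

  InFq-^qʲ : ∀ {x} → InFq x → ∀ j → x ^ (q ℕ.^ j) ≡ x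
  InFq-^qʲ {x} x∈ zero    = *-identityʳ x
  InFq-^qʲ {x} x∈ (suc j) = trans (sym (^-*-assoc x q (q ℕ.^ j))) (trans (cong (_^ (q ℕ.^ j)) x∈) (InFq-^qʲ x∈ j))

  ω^[t*n]≡1 : ∀ t → ω ^ (t ℕ.* n) ≡ 1#
  ω^[t*n]≡1 t = trans (cong (ω ^_) (ℕ.*-comm t n)) (trans (sym (^-*-assoc ω n t)) (trans (cong (_^ t) ω^n≡1) (1^n≡1 t)))

  -- σ t, t < Q, runs through 𝔽_q^*
  σ : ℕ → Carrier
  σ t = ω ^ (t ℕ.* b ℕ.* k)

  σ-InFq : ∀ t → InFq (σ t)
  σ-InFq t = begin
    σ t ^ q
      ≡⟨ ^-*-assoc ω (t ℕ.* b ℕ.* k) q ⟩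
    ω ^ (t ℕ.* b ℕ.* k ℕ.* q)
      ≡⟨ cong (ω ^_) (trans (cong (t ℕ.* b ℕ.* k ℕ.*_) q≡1+Q) (expand t b k Q)) ⟩
    ω ^ (t ℕ.* b ℕ.* k ℕ.+ t ℕ.* (k ℕ.* (b ℕ.* Q)))
      ≡⟨ ^-homo-* ω (t ℕ.* b ℕ.* k) _ ⟩
    σ t * ω ^ (t ℕ.* (k ℕ.* (b ℕ.* Q)))
      ≡⟨ cong (λ m → σ t * ω ^ (t ℕ.* m)) (sym n≡k*b*Q) ⟩
    σ t * ω ^ (t ℕ.* n)
      ≡⟨ cong (σ t *_) (ω^[t*n]≡1 t) ⟩
    σ t * 1#
      ≡⟨ *-identityʳ _ ⟩
    σ t                                      ∎
    where
    open ≡-Reasoning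
    expand : ∀ t b k Q → t ℕ.* b ℕ.* k ℕ.* suc Q ≡ t ℕ.* b ℕ.* k ℕ.+ t ℕ.* (k ℕ.* (b ℕ.* Q))
    expand = solve-∀

  σ-nonzero : ∀ t → σ t ≢ 0#
  σ-nonzero t = ω^-nonzero (t ℕ.* b ℕ.* k)

  private
    t*b*k<n : ∀ {t} → t < Q → t ℕ.* b ℕ.* k < n
    t*b*k<n {t} t<Q = subst₂ _<_ (sym (ℕ.*-assoc t b k)) (trans (regroup Q b k) (sym n≡k*b*Q))
                             (ℕ.*-monoˡ-< (b ℕ.* k) {{ℕ.m*n≢0 b k}} t<Q)
      where
      regroup : ∀ Q b k → Q ℕ.* (b ℕ.* k) ≡ k ℕ.* (b ℕ.* Q)
      regroup = solve-∀

    reorder : ∀ t b k → t ℕ.* b ℕ.* k ≡ t ℕ.* (k ℕ.* b)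
    reorder = solve-∀

    -- c ∈ 𝔽_q^* gives c^(q-1) = 1, so ω^m = c forces n ∣ m (q - 1), i.e. b k ∣ m
    k*b∣log : ∀ {c m} → c ≢ 0# → InFq c → ω ^ m ≡ c → k ℕ.* b ∣ m
    k*b∣log {c} {m} c≢0 c∈ ωᵐ≡c =
      ℕ∣.*-cancelʳ-∣ Q (subst (_∣ m ℕ.* Q) (trans n≡k*b*Q (sym (ℕ.*-assoc k b Q)))
                             (order-∣ (trans (sym (^-*-assoc ω m Q)) (trans (cong (_^ Q) ωᵐ≡c) cᵠ≡1))))
      where
      cᵠ≡1 : c ^ Q ≡ 1#
      cᵠ≡1 = sym (*-cancelˡ 1# (c ^ Q) c≢0 (trans (*-identityʳ c) (trans (sym c∈) (cong (c ^_) q≡1+Q))))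

  σ-unique : ∀ {c} → c ≢ 0# → InFq c → ∃ λ t₀ → t₀ < Q × σ t₀ ≡ c × (∀ {t} → t < Q → σ t ≡ c → t ≡ t₀)
  σ-unique {c} c≢0 c∈ = from-log (discrete-log c c≢0)
    where
    from-log : (∃ λ m → m < n × ω ^ m ≡ c) → ∃ λ t₀ → t₀ < Q × σ t₀ ≡ c × (∀ {t} → t < Q → σ t ≡ c → t ≡ t₀)
    from-log (m , m<n , ωᵐ≡c) = t₀ , t₀<Q , σt₀≡c , unique
      where
      t₀ = ℕ∣._∣_.quotient (k*b∣log c≢0 c∈ ωᵐ≡c)
      m≡t₀*kb : m ≡ t₀ ℕ.* (k ℕ.* b)
      m≡t₀*kb = ℕ∣._∣_.equality (k*b∣log c≢0 c∈ ωᵐ≡c)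
      t₀<Q : t₀ < Q
      t₀<Q = ℕ.*-cancelʳ-< (k ℕ.* b) t₀ Q (subst₂ _<_ m≡t₀*kb (trans n≡k*b*Q (regroup Q b k)) m<n)
        where
        regroup : ∀ Q b k → k ℕ.* (b ℕ.* Q) ≡ Q ℕ.* (k ℕ.* b)
        regroup = solve-∀
      σt₀≡c : σ t₀ ≡ c
      σt₀≡c = trans (cong (ω ^_) (trans (reorder t₀ b k) (sym m≡t₀*kb))) ωᵐ≡c
      unique : ∀ {t} → t < Q → σ t ≡ c → t ≡ t₀
      unique {t} t<Q σt≡c = ℕ.*-cancelʳ-≡ t t₀ (k ℕ.* b) {{ℕ.m*n≢0 k b}}
        (trans (sym (reorder t b k)) (trans (ω^-injective (t*b*k<n t<Q) (t*b*k<n t₀<Q) (trans σt≡c (sym σt₀≡c))) (reorder t₀ b k)))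

  coeff : ℕ → Carrier → ℚ
  coeff r c = if isYes (c ≟ 0#) then aZero q r else aNonZero q r

  coeff-zero : ∀ r {c} → c ≡ 0# → coeff r c ≡ aZero q r
  coeff-zero r {c} c≡0 = cong (if_then aZero q r else aNonZero q r) (trans (isYes≗does (c ≟ 0#)) (dec-true (c ≟ 0#) c≡0))

  coeff-nonzero : ∀ r {c} → c ≢ 0# → coeff r c ≡ aNonZero q r
  coeff-nonzero r {c} c≢0 = cong (if_then aZero q r else aNonZero q r) (trans (isYes≗does (c ≟ 0#)) (dec-false (c ≟ 0#) c≢0))

  private
    aNonZero-suc′ : ∀ r → aNonZero q (suc r) ≡ ℕ→ℚ Q ℚ.* aNonZero q r ℚ.+ (aZero q r ℚ.- aNonZero q r)
    aNonZero-suc′ r = subst (λ q′ → aNonZero q′ (suc r) ≡ ℕ→ℚ (q′ ∸ 1) ℚ.* aNonZero q′ r ℚ.+ (aZero q′ r ℚ.- aNonZero q′ r))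
                            (sym q≡1+Q) (aNonZero-suc Q r)

    coeff-suc-zero : ∀ r {c} → c ≡ 0# → coeff (suc r) c ≡ ℚSums.∑< Q (λ t → coeff r (c - σ t))
    coeff-suc-zero r {c} c≡0 = trans (coeff-zero (suc r) c≡0) (trans (aZero-suc q r)
      (sym (trans (ℚSums.∑<-cong Q λ t _ → coeff-nonzero r λ eq → σ-nonzero t (trans (sym (x-y≡0⇒x≡y c (σ t) eq)) c≡0))
                  (∑<-const Q (aNonZero q r)))))

    coeff-suc-σ : ∀ r {c} → (∃ λ t₀ → t₀ < Q × σ t₀ ≡ c × (∀ {t} → t < Q → σ t ≡ c → t ≡ t₀)) →
                  coeff (suc r) c ≡ ℚSums.∑< Q (λ t → coeff r (c - σ t))
    coeff-suc-σ r {c} (t₀ , t₀<Q , σt₀≡c , unique) =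
      trans (coeff-nonzero (suc r) (λ c≡0 → σ-nonzero t₀ (trans σt₀≡c c≡0))) (sym (begin
      ℚSums.∑< Q a′
        ≡⟨ ℚSums.∑<-cong Q (λ t _ → split (a′ t) aN) ⟩
      ℚSums.∑< Q (λ t → aN ℚ.+ (a′ t ℚ.- aN))
        ≡⟨ ℚSums.∑<-distrib-+ Q (λ _ → aN) (λ t → a′ t ℚ.- aN) ⟩
      ℚSums.∑< Q (λ _ → aN) ℚ.+ ℚSums.∑< Q (λ t → a′ t ℚ.- aN)
        ≡⟨ cong₂ ℚ._+_ (∑<-const Q aN) (ℚSums.∑<-delta Q t₀ t₀<Q off-t₀) ⟩
      ℕ→ℚ Q ℚ.* aN ℚ.+ (a′ t₀ ℚ.- aN)
        ≡⟨ cong (λ x → ℕ→ℚ Q ℚ.* aN ℚ.+ (x ℚ.- aN))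
             (coeff-zero r (trans (cong (λ x → c - x) σt₀≡c) (-‿inverseʳ c))) ⟩
      ℕ→ℚ Q ℚ.* aN ℚ.+ (aZero q r ℚ.- aN)
        ≡⟨ sym (aNonZero-suc′ r) ⟩
      aNonZero q (suc r)                                       ∎))
      where
      open ≡-Reasoning
      aN = aNonZero q r
      a′ = λ t → coeff r (c - σ t)
      split : ∀ x y → x ≡ y ℚ.+ (x ℚ.- y)
      split = ℚ-Solver.solve-∀ ℚ-ring
      off-t₀ : ∀ t → t < Q → t ≢ t₀ → a′ t ℚ.- aN ≡ 0ℚ
      off-t₀ t t<Q t≢t₀ = trans (cong (ℚ._- aN) (coeff-nonzero r λ eq → t≢t₀ (unique t<Q (sym (x-y≡0⇒x≡y c (σ t) eq)))))
                                (ℚ.+-inverseʳ aN)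

  -- c - σ t vanishes for no t (if c = 0) or for exactly one t (if c ≠ 0)
  coeff-suc : ∀ r {c} → InFq c → coeff (suc r) c ≡ ℚSums.∑< Q (λ t → coeff r (c - σ t))
  coeff-suc r {c} c∈ = by-cases (c ≟ 0#)
    where
    by-cases : Dec (c ≡ 0#) → coeff (suc r) c ≡ ℚSums.∑< Q (λ t → coeff r (c - σ t))
    by-cases (yes c≡0) = coeff-suc-zero r c≡0
    by-cases (no  c≢0) = coeff-suc-σ r (σ-unique c≢0 c∈)

  rhs : (m : ℕ) → ℕ → (Fin m → Carrier) → ℚ
  rhs m r u = convolve m r (λ i s → coeff s (u i))

  rhs-suc : ∀ m r (u : Fin m → Carrier) → (∀ i → InFq (u i)) →
            rhs m (suc r) u ≡ ∑[ i < m ] ℚSums.∑< Q (λ t → rhs m r (updateAt u i (_- σ t)))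
  rhs-suc zero    r u u∈ = refl
  rhs-suc (suc m) r u u∈ = begin
    ℚSums.conv (suc r) f g                              ≡⟨ ℚSums.conv-suc r f g ⟩
    ℚSums.conv r (f ∘ suc) g ℚ.+ ℚSums.conv r f (g ∘ suc)     ≡⟨ cong₂ ℚ._+_ first rest ⟩
    ℚSums.∑< Q (λ t → ℚSums.conv r (λ s → coeff s (u Fin.zero - σ t)) g) ℚ.+
      ∑[ i < m ] ℚSums.∑< Q (λ t → ℚSums.conv r f (λ s → rhs m s (updateAt (u ∘ Fin.suc) i (_- σ t)))) ∎
    where
    open ≡-Reasoning
    f = λ s → coeff s (u Fin.zero)
    g = λ s → rhs m s (u ∘ Fin.suc)
    first : ℚSums.conv r (f ∘ suc) g ≡ ℚSums.∑< Q (λ t → ℚSums.conv r (λ s → coeff s (u Fin.zero - σ t)) g)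
    first = trans (ℚSums.conv-cong r {f ∘ suc} {λ s → ℚSums.∑< Q (λ t → coeff s (u Fin.zero - σ t))} {g} {g}
                                   (λ s _ → coeff-suc s (u∈ Fin.zero)) (λ _ _ → refl))
                  (ℚSums.conv-∑<ˡ r Q (λ t s → coeff s (u Fin.zero - σ t)) g)
    rest : ℚSums.conv r f (g ∘ suc) ≡
           ∑[ i < m ] ℚSums.∑< Q (λ t → ℚSums.conv r f (λ s → rhs m s (updateAt (u ∘ Fin.suc) i (_- σ t))))
    rest = trans (ℚSums.conv-cong r {f} {f} {g ∘ suc} {λ s → ∑[ i < m ] ℚSums.∑< Q (h i s)}
                                  (λ _ _ → refl) (λ s _ → rhs-suc m s (u ∘ Fin.suc) (u∈ ∘ Fin.suc)))
                 (trans (ℚSums.conv-∑ʳ r m f (λ i s → ℚSums.∑< Q (h i s)))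
                        (ℚSums.sum-cong-≗ λ i → ℚSums.conv-∑<ʳ r Q f (λ t s → h i s t)))
      where
      h : Fin m → ℕ → ℕ → ℚ
      h i s t = rhs m s (updateAt (u ∘ Fin.suc) i (_- σ t))

  rhs-zero-all : ∀ m (u : Fin m → Carrier) → (∀ i → u i ≡ 0#) → rhs m 0 u ≡ 1ℚ
  rhs-zero-all zero    u _   = refl
  rhs-zero-all (suc m) u u≡0 = trans (ℚ.+-identityˡ _)
    (trans (cong₂ (λ x y → 1ℚ ℚ.* (x ℚ.* y)) (coeff-zero 0 (u≡0 Fin.zero)) (rhs-zero-all m (u ∘ Fin.suc) (u≡0 ∘ Fin.suc)))
           refl)

  rhs-zero-some : ∀ m (u : Fin m → Carrier) i → u i ≢ 0# → rhs m 0 u ≡ 0ℚ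
  rhs-zero-some (suc m) u Fin.zero    uᵢ≢0 = trans (ℚ.+-identityˡ _)
    (trans (cong (λ x → 1ℚ ℚ.* (x ℚ.* rhs m 0 (u ∘ Fin.suc))) (trans (coeff-nonzero 0 uᵢ≢0) (aNonZero-zero q)))
           (trans (cong (1ℚ ℚ.*_) (ℚ.*-zeroˡ (rhs m 0 (u ∘ Fin.suc)))) refl))
  rhs-zero-some (suc m) u (Fin.suc i) uᵢ≢0 = trans (ℚ.+-identityˡ _)
    (trans (cong (λ x → 1ℚ ℚ.* (coeff 0 (u Fin.zero) ℚ.* x)) (rhs-zero-some m (u ∘ Fin.suc) i uᵢ≢0))
           (trans (cong (1ℚ ℚ.*_) (ℚ.*-zeroʳ (coeff 0 (u Fin.zero)))) refl))

  θ : Carrier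
  θ = ω ^ k

  basis : Fin b → Carrier
  basis i = ω ^ (toℕ i ℕ.* k)

  conjugate : Fin b → Carrier
  conjugate j = θ ^ (q ℕ.^ toℕ j)

  qʲ≡p^[a*j] : ∀ j → q ℕ.^ j ≡ p ℕ.^ (a ℕ.* j)
  qʲ≡p^[a*j] j = ℕ.^-*-assoc p a j

  private
    -- θ^(qⁱ) = θ^(qʲ) with i < j gives b (q - 1) ∣ q^(j - i) - 1, against primitivity
    conjugate-distinct : ∀ i j → toℕ i < toℕ j → conjugate i ≢ conjugate j
    conjugate-distinct i j i<j eq = proj₂ primitive-divisor (a ℕ.* d) (ℕ.*-mono-≤ 1≤a 0<d)
                                          (ℕ.*-monoʳ-< a {{ℕ.>-nonZero 1≤a}} d<b) b*Q∣
      where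
      d = toℕ j ∸ toℕ i
      0<d : 0 < d
      0<d = ℕ.m<n⇒0<n∸m i<j
      d<b : d < b
      d<b = ℕ.≤-<-trans (ℕ.m∸n≤m (toℕ j) (toℕ i)) (Fin.toℕ<n j)
      θ≡θ^qᵈ : θ ≡ θ ^ (q ℕ.^ d)
      θ≡θ^qᵈ = frobenius-injective (a ℕ.* toℕ i) (subst (λ e → θ ^ e ≡ (θ ^ (q ℕ.^ d)) ^ e) (qʲ≡p^[a*j] (toℕ i)) (begin
        θ ^ (q ℕ.^ toℕ i)
          ≡⟨ eq ⟩
        θ ^ (q ℕ.^ toℕ j)
          ≡⟨ cong (λ e → θ ^ (q ℕ.^ e)) (sym (ℕ.m+[n∸m]≡n (ℕ.<⇒≤ i<j))) ⟩
        θ ^ (q ℕ.^ (toℕ i ℕ.+ d))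
          ≡⟨ cong (θ ^_) (trans (ℕ.^-distribˡ-+-* q (toℕ i) d) (ℕ.*-comm (q ℕ.^ toℕ i) (q ℕ.^ d))) ⟩
        θ ^ (q ℕ.^ d ℕ.* q ℕ.^ toℕ i)
          ≡⟨ sym (^-*-assoc θ (q ℕ.^ d) (q ℕ.^ toℕ i)) ⟩
        (θ ^ (q ℕ.^ d)) ^ (q ℕ.^ toℕ i)     ∎))
        where open ≡-Reasoning
      k≤k*qᵈ : k ≤ k ℕ.* q ℕ.^ d
      k≤k*qᵈ = ℕ.m≤m*n k (q ℕ.^ d) {{ℕ.m^n≢0 q d {{ℕ.>-nonZero (ℕ.<-≤-trans (s≤s z≤n) 2≤q)}}}}
      n∣k*[qᵈ-1] : n ∣ k ℕ.* (q ℕ.^ d ∸ 1)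
      n∣k*[qᵈ-1] = subst (n ∣_) (trans (cong (k ℕ.* q ℕ.^ d ∸_) (sym (ℕ.*-identityʳ k))) (sym (ℕ.*-distribˡ-∸ k (q ℕ.^ d) 1)))
                         (order-∣ (ω^-cancel k≤k*qᵈ (trans θ≡θ^qᵈ (^-*-assoc ω k (q ℕ.^ d)))))
      b*Q∣ : b ℕ.* Q ∣ p ℕ.^ (a ℕ.* d) ∸ 1
      b*Q∣ = subst (λ m → b ℕ.* Q ∣ m ∸ 1) (qʲ≡p^[a*j] d) (ℕ∣.*-cancelˡ-∣ k (subst (_∣ k ℕ.* (q ℕ.^ d ∸ 1)) n≡k*b*Q n∣k*[qᵈ-1]))

  conjugate-injective : ∀ {i j} → conjugate i ≡ conjugate j → i ≡ j
  conjugate-injective {i} {j} eq = by-cases (ℕ.<-cmp (toℕ i) (toℕ j))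
    where
    by-cases : Tri (toℕ i < toℕ j) (toℕ i ≡ toℕ j) (toℕ j < toℕ i) → i ≡ j
    by-cases (tri< i<j _ _) = ⊥-elim (conjugate-distinct i j i<j eq)
    by-cases (tri≈ _ i≡j _) = Fin.toℕ-injective i≡j
    by-cases (tri> _ _ j<i) = ⊥-elim (conjugate-distinct j i j<i (sym eq))

  -- conjugating ∑ uᵢ θⁱ = 0 by x ↦ x^(qʲ) fixes the uᵢ, so every conjugate is a root of ∑ uᵢ Xⁱ
  conjugates-are-roots : ∀ (u : Fin b → Carrier) → (∀ i → InFq (u i)) → sum (λ i → u i * basis i) ≡ 0# →
                         ∀ j → horner b u (conjugate j) ≡ 0#
  conjugates-are-roots u u∈ ∑≡0 j = begin
    horner b u (conjugate j)                      ≡⟨ horner≡∑ b u (conjugate j) ⟩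
    sum (λ i → u i * conjugate j ^ toℕ i)         ≡⟨ sum-cong-≗ (λ i → sym (conjugate-term i)) ⟩
    sum (λ i → (u i * basis i) ^ (p ℕ.^ e))       ≡⟨ sym (frobenius-∑ e b (λ i → u i * basis i)) ⟩
    sum (λ i → u i * basis i) ^ (p ℕ.^ e)         ≡⟨ cong (_^ (p ℕ.^ e)) ∑≡0 ⟩
    0# ^ (p ℕ.^ e)                                ≡⟨ 0^n≡0 _ (ℕ.m^n>0 p e) ⟩
    0#                                            ∎
    where
    open ≡-Reasoning
    e = a ℕ.* toℕ j
    P = q ℕ.^ toℕ j
    conjugate-term : ∀ i → (u i * basis i) ^ (p ℕ.^ e) ≡ u i * conjugate j ^ toℕ i
    conjugate-term i = begin
      (u i * basis i) ^ (p ℕ.^ e)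
        ≡⟨ cong ((u i * basis i) ^_) (sym (qʲ≡p^[a*j] (toℕ j))) ⟩
      (u i * basis i) ^ P
        ≡⟨ ^-distrib-* (u i) (basis i) P ⟩
      u i ^ P * basis i ^ P
        ≡⟨ cong₂ _*_ (InFq-^qʲ (u∈ i) (toℕ j)) (^-*-assoc ω (toℕ i ℕ.* k) P) ⟩
      u i * ω ^ (toℕ i ℕ.* k ℕ.* P)
        ≡⟨ cong (λ m → u i * ω ^ m) (regroup (toℕ i) k P) ⟩
      u i * ω ^ (k ℕ.* (P ℕ.* toℕ i))
        ≡⟨ cong (u i *_) (sym (trans (^-*-assoc θ P (toℕ i)) (^-*-assoc ω k (P ℕ.* toℕ i)))) ⟩
      u i * conjugate j ^ toℕ i          ∎
      where
      regroup : ∀ i k P → i ℕ.* k ℕ.* P ≡ k ℕ.* (P ℕ.* i)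
      regroup = solve-∀

  basis-independent : ∀ (u : Fin b → Carrier) → (∀ i → InFq (u i)) → sumFin b (λ i → u i * basis i) ≡ 0# →
                      ∀ i → u i ≡ 0#
  basis-independent u u∈ ∑≡0 =
    distinct-roots⇒zero b u conjugate conjugate-injective (conjugates-are-roots u u∈ (trans (sym (sumFin≡∑ b _)) ∑≡0))

  ^k-periodic : ∀ m → (ω ^ (b ℕ.* Q ℕ.+ m)) ^ k ≡ (ω ^ m) ^ k
  ^k-periodic m = begin
    (ω ^ (b ℕ.* Q ℕ.+ m)) ^ k             ≡⟨ cong (_^ k) (^-homo-* ω (b ℕ.* Q) m) ⟩
    (ω ^ (b ℕ.* Q) * ω ^ m) ^ k           ≡⟨ ^-distrib-* (ω ^ (b ℕ.* Q)) (ω ^ m) k ⟩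
    (ω ^ (b ℕ.* Q)) ^ k * (ω ^ m) ^ k     ≡⟨ cong (_* (ω ^ m) ^ k) ω^[bQk]≡1 ⟩
    1# * (ω ^ m) ^ k                      ≡⟨ *-identityˡ _ ⟩
    (ω ^ m) ^ k                           ∎
    where
    open ≡-Reasoning
    ω^[bQk]≡1 : (ω ^ (b ℕ.* Q)) ^ k ≡ 1#
    ω^[bQk]≡1 = trans (^-*-assoc ω (b ℕ.* Q) k) (trans (cong (ω ^_) (trans (ℕ.*-comm _ k) (sym n≡k*b*Q))) ω^n≡1)

  ^k-blocks : ∀ t i → (ω ^ (t ℕ.* b ℕ.+ i)) ^ k ≡ σ t * ω ^ (i ℕ.* k)
  ^k-blocks t i = trans (^-*-assoc ω (t ℕ.* b ℕ.+ i) k)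
                        (trans (cong (ω ^_) (ℕ.*-distribʳ-+ k (t ℕ.* b) i)) (^-homo-* ω (t ℕ.* b ℕ.* k) (i ℕ.* k)))

  -- x^k for x ≠ 0 takes each value σ t · basis i exactly k times
  N-suc-ℚ : ∀ r α → ℕ→ℚ (N (suc r) α) ≡ ℕ→ℚ k ℚ.* ℚSums.∑< Q (λ t → ∑[ i < b ] ℕ→ℚ (N r (α - σ t * basis i)))
  N-suc-ℚ r α = begin
    ℕ→ℚ (N (suc r) α)
      ≡⟨ cong ℕ→ℚ (N-suc r α) ⟩
    ℕ→ℚ (ℕSums.∑ˡ elements (λ x → if does (x ≟ 0#) then 0 else N r (α - x ^ k)))
      ≡⟨ ℕ→ℚ-∑ˡ elements _ ⟩
    ℚSums.∑ˡ elements (λ x → ℕ→ℚ (if does (x ≟ 0#) then 0 else N r (α - x ^ k)))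
      ≡⟨ ℚSums.∑ˡ-cong elements (λ x → ℕ→ℚ-if (does (x ≟ 0#))) ⟩
    ℚSums.∑ˡ elements (λ x → if does (x ≟ 0#) then 0ℚ else G x)
      ≡⟨ ∑ˡ-elements _ ⟩
    ∑[ i < suc n ] (if does (element i ≟ 0#) then 0ℚ else G (element i))
      ≡⟨ ∑-nonzero≡∑<-powers G ⟩
    ℚSums.∑< n (G ∘ (ω ^_))
      ≡⟨ cong (λ m → ℚSums.∑< m (G ∘ (ω ^_))) n≡k*b*Q ⟩
    ℚSums.∑< (k ℕ.* (b ℕ.* Q)) (G ∘ (ω ^_))
      ≡⟨ ℚSums.∑<-periodic k (b ℕ.* Q) (G ∘ (ω ^_))
           (λ m → cong (λ x → ℕ→ℚ (N r (α - x))) (^k-periodic m)) ⟩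
    ℚSums.∑< k (λ _ → ℚSums.∑< (b ℕ.* Q) (G ∘ (ω ^_)))
      ≡⟨ ∑<-const k _ ⟩
    ℕ→ℚ k ℚ.* ℚSums.∑< (b ℕ.* Q) (G ∘ (ω ^_))
      ≡⟨ cong (λ m → ℕ→ℚ k ℚ.* ℚSums.∑< m (G ∘ (ω ^_))) (ℕ.*-comm b Q) ⟩
    ℕ→ℚ k ℚ.* ℚSums.∑< (Q ℕ.* b) (G ∘ (ω ^_))
      ≡⟨ cong (ℕ→ℚ k ℚ.*_) (ℚSums.∑<-blocks Q b (G ∘ (ω ^_))) ⟩
    ℕ→ℚ k ℚ.* ℚSums.∑< Q (λ t → ℚSums.∑< b (λ i → G (ω ^ (t ℕ.* b ℕ.+ i))))
      ≡⟨ cong (ℕ→ℚ k ℚ.*_) (ℚSums.∑<-cong Q λ t _ → block t) ⟩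
    ℕ→ℚ k ℚ.* ℚSums.∑< Q (λ t → ∑[ i < b ] ℕ→ℚ (N r (α - σ t * basis i))) ∎
    where
    open ≡-Reasoning
    G : Carrier → ℚ
    G x = ℕ→ℚ (N r (α - x ^ k))
    block : ∀ t → ℚSums.∑< b (λ i → G (ω ^ (t ℕ.* b ℕ.+ i))) ≡ ∑[ i < b ] ℕ→ℚ (N r (α - σ t * basis i))
    block t = trans (ℚSums.∑<-cong b λ i _ → cong (λ x → ℕ→ℚ (N r (α - x))) (^k-blocks t i))
                    (sym (ℚSums.∑-toℕ b λ i → ℕ→ℚ (N r (α - σ t * ω ^ (i ℕ.* k)))))
    ℕ→ℚ-if : ∀ d {m} → ℕ→ℚ (if d then 0 else m) ≡ (if d then 0ℚ else ℕ→ℚ m)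
    ℕ→ℚ-if true  = refl
    ℕ→ℚ-if false = refl

  N≡kʳ*rhs : ∀ r α (u : Fin b → Carrier) → (∀ i → InFq (u i)) → α ≡ sumFin b (λ i → u i * basis i) →
          ℕ→ℚ (N r α) ≡ ℕ→ℚ (k ℕ.^ r) ℚ.* rhs b r u
  N≡kʳ*rhs zero α u u∈ α≡∑ = by-cases (Fin.all? (λ i → u i ≟ 0#))
    where
    some-nonzero : (∃ λ i → u i ≢ 0#) → ℕ→ℚ (N 0 α) ≡ ℕ→ℚ 1 ℚ.* rhs b 0 u
    some-nonzero (i , uᵢ≢0) = trans (cong ℕ→ℚ (trans (N-zero α) (cong (if_then 1 else 0) (dec-false (0# ≟ α) α≢0))))
                                    (sym (trans (cong (ℕ→ℚ 1 ℚ.*_) (rhs-zero-some b u i uᵢ≢0)) (ℚ.*-zeroʳ (ℕ→ℚ 1))))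
      where
      α≢0 : 0# ≢ α
      α≢0 0≡α = uᵢ≢0 (basis-independent u u∈ (trans (sym α≡∑) (sym 0≡α)) i)
    by-cases : Dec (∀ i → u i ≡ 0#) → ℕ→ℚ (N 0 α) ≡ ℕ→ℚ 1 ℚ.* rhs b 0 u
    by-cases (yes u≡0) = trans (cong ℕ→ℚ (trans (N-zero α) (cong (if_then 1 else 0) (dec-true (0# ≟ α) (sym α≡0)))))
                               (sym (trans (cong (ℕ→ℚ 1 ℚ.*_) (rhs-zero-all b u u≡0)) refl))
      where
      α≡0 : α ≡ 0#
      α≡0 = trans α≡∑ (trans (sumFin≡∑ b _) (∑-zero b λ i → trans (cong (_* basis i) (u≡0 i)) (zeroˡ _)))
    by-cases (no ¬u≡0) = some-nonzero (Fin.¬∀⟶∃¬ b (λ i → u i ≡ 0#) (λ i → u i ≟ 0#) ¬u≡0)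
  N≡kʳ*rhs (suc r) α u u∈ α≡∑ = begin
    ℕ→ℚ (N (suc r) α)
      ≡⟨ N-suc-ℚ r α ⟩
    ℕ→ℚ k ℚ.* ℚSums.∑< Q (λ t → ∑[ i < b ] ℕ→ℚ (N r (α - σ t * basis i)))
      ≡⟨ cong (ℕ→ℚ k ℚ.*_) (ℚSums.∑<-cong Q λ t _ → ℚSums.sum-cong-≗ λ i →
           N≡kʳ*rhs r _ (updateAt u i (_- σ t)) (updated∈ i t) (updated-coordinates i t)) ⟩
    ℕ→ℚ k ℚ.* ℚSums.∑< Q (λ t → ∑[ i < b ] (ℕ→ℚ (k ℕ.^ r) ℚ.* rhs b r (updateAt u i (_- σ t))))
      ≡⟨ cong (ℕ→ℚ k ℚ.*_) (trans (ℚSums.∑<-cong Q λ t _ →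
                                     sym (ℚSums.*-distribˡ-sum (ℕ→ℚ (k ℕ.^ r)) (λ i → rhs b r (updateAt u i (_- σ t)))))
                                  (sym (ℚSums.*-distribˡ-∑< Q (ℕ→ℚ (k ℕ.^ r)) _))) ⟩
    ℕ→ℚ k ℚ.* (ℕ→ℚ (k ℕ.^ r) ℚ.* ℚSums.∑< Q (λ t → ∑[ i < b ] rhs b r (updateAt u i (_- σ t))))
      ≡⟨ sym (ℚ.*-assoc (ℕ→ℚ k) (ℕ→ℚ (k ℕ.^ r)) _) ⟩
    ℕ→ℚ k ℚ.* ℕ→ℚ (k ℕ.^ r) ℚ.* ℚSums.∑< Q (λ t → ∑[ i < b ] rhs b r (updateAt u i (_- σ t)))
      ≡⟨ cong₂ ℚ._*_ (sym (ℕ→ℚ-homo-* k (k ℕ.^ r)))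
                     (trans (sym (ℚSums.∑-comm-∑< b Q λ i t → rhs b r (updateAt u i (_- σ t)))) (sym (rhs-suc b r u u∈))) ⟩
    ℕ→ℚ (k ℕ.^ suc r) ℚ.* rhs b (suc r) u ∎
    where
    open ≡-Reasoning
    updated∈ : ∀ i t j → InFq (updateAt u i (_- σ t) j)
    updated∈ i t j = by-cases (j Fin.≟ i)
      where
      by-cases : Dec (j ≡ i) → InFq (updateAt u i (_- σ t) j)
      by-cases (yes j≡i) = subst InFq (sym (trans (cong (updateAt u i (_- σ t)) j≡i) (updateAt-updates i u)))
                                 (InFq-− (u∈ i) (σ-InFq t))
      by-cases (no  j≢i) = subst InFq (sym (updateAt-minimal j i u j≢i)) (u∈ j)
    updated-coordinates : ∀ i t → α - σ t * basis i ≡ sumFin b (λ j → updateAt u i (_- σ t) j * basis j)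
    updated-coordinates i t = trans (cong (_- σ t * basis i) α≡∑) (sym (coordinates-updateAt b u basis i (σ t)))

  formula≡kʳ*rhs : ∀ r (u : Fin b → Carrier) →
                formula q b k r (λ i → isYes (u i ≟ 0#)) ≡ ℕ→ℚ (k ℕ.^ r) ℚ.* rhs b r u
  formula≡kʳ*rhs r u = cong (ℕ→ℚ (k ℕ.^ r) ℚ.*_)
    (trans (cong (List.foldr ℚ._+_ 0ℚ) (List.map-cong (λ rs → cong (multinomial r rs ℚ.*_) (prodA≡∏ rs)) (compositions b r)))
           (MultinomialExpansion.multinomial-expansion b r (λ i s → coeff s (u i))))
    where
    prodA≡∏ : ∀ rs → prodA q (λ i → isYes (u i ≟ 0#)) rs ≡ MultinomialExpansion.∏ (λ i s → coeff s (u i)) rs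
    prodA≡∏ rs = refl

open import Data.Nat using (_^_; _*_)

proposition4p3 :
    (p a b k : ℕ) → Prime p → 1 ≤ a → 1 < b →
    k * (b * (p ^ a ∸ 1)) ≡ p ^ (a * b) ∸ 1 →
    PrimitiveDivisor p (a * b) (b * (p ^ a ∸ 1)) →
    (F : FiniteField) → FiniteField.size F ≡ p ^ (a * b) →
    (ω : FiniteField.Carrier F) → FiniteField.IsPrimitiveElement F ω →
    (α : FiniteField.Carrier F) → (c : Fin b → FiniteField.Carrier F) →
    FiniteField.IsCoordinates F (p ^ a) b k ω α c →
    (r : ℕ) →
    ℕ→ℚ (FiniteField.numSolutions F r k α)
      ≡ formula (p ^ a) b k r
          (λ i → isYes (FiniteField._≟_ F (c i) (FiniteField.0# F)))
proposition4p3 p a b k p-prime 1≤a 1<b k-def primitive-divisor F size≡pᵃᵇ ω ω-primitive α c (c∈𝔽q , α≡∑) r =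
  trans (N≡kʳ*rhs r α c c∈𝔽q α≡∑) (sym (formula≡kʳ*rhs r c))
  where open Setting p a b k p-prime 1≤a 1<b k-def primitive-divisor F size≡pᵃᵇ ω ω-primitive
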